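{- Over ZFU, RP implies Collection $\land$ RP$^\sim$.
   Context: Urelement set theory ZFU: language $\in$ plus a unary predicate $\mathcal{A}$ for urelements; axioms Foundation, Pairing, Union, Powerset, Infinity, Separation, Replacement, Extensionality for sets, urelements have no members; a proper class of urelements allowed; no Choice. $\varphi^t$ is relativization to $t$. RP (schema): $\forall x\,\exists t\,(x\subseteq t\land t$ is a transitive set $\land\forall v\in t\,(\varphi(v)\leftrightarrow\varphi^t(v)))$. Collection (schema): $\forall w,p\,(\forall x\in w\,\exists y\,\varphi(x,y,p)\to\exists v\,\forall x\in w\,\exists y\in v\,\varphi(x,y,p))$. A set is supertransitive if it is transitive and contains every subset of each of its members as a member. RP$^\sim$ (schema): $\forall x\,(\varphi(x)\to\exists t\,(x\in t\land t$ is supertransitive $\land\varphi^t(x)))$. -}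

module Defs where

open import Data.Nat using (ℕ; zero; suc; _+_)
open import Data.Fin using (Fin; zero; suc)

-- Syntax of first-order formulas in the language {∈, 𝒜} with equality.
-- Variables are de Bruijn indices: Fm n = formulas with n free variables
-- (index 0 = innermost bound variable).

infixr 4 _⇒_
infixr 5 _∨ᶠ_
infixr 6 _∧ᶠ_
infix 3 _⇔ᶠ_
infix 9 _∈ᶠ_ _≐_

data Fm : ℕ → Set where
  _∈ᶠ_ : ∀ {n} → Fin n → Fin n → Fm n
  _≐_  : ∀ {n} → Fin n → Fin n → Fm n
  𝒜    : ∀ {n} → Fin n → Fm n          -- "is an urelement"
  ⊥ᶠ   : ∀ {n} → Fm n
  _⇒_  : ∀ {n} → Fm n → Fm n → Fm n
  ∀ᶠ   : ∀ {n} → Fm (suc n) → Fm n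

¬ᶠ : ∀ {n} → Fm n → Fm n
¬ᶠ φ = φ ⇒ ⊥ᶠ

_∨ᶠ_ : ∀ {n} → Fm n → Fm n → Fm n
φ ∨ᶠ ψ = ¬ᶠ φ ⇒ ψ

_∧ᶠ_ : ∀ {n} → Fm n → Fm n → Fm n
φ ∧ᶠ ψ = ¬ᶠ (φ ⇒ ¬ᶠ ψ)

_⇔ᶠ_ : ∀ {n} → Fm n → Fm n → Fm n
φ ⇔ᶠ ψ = (φ ⇒ ψ) ∧ᶠ (ψ ⇒ φ)

∃ᶠ : ∀ {n} → Fm (suc n) → Fm n
∃ᶠ φ = ¬ᶠ (∀ᶠ (¬ᶠ φ))

v0 : ∀ {n} → Fin (suc n)
v0 = zero
v1 : ∀ {n} → Fin (suc (suc n))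
v1 = suc zero
v2 : ∀ {n} → Fin (suc (suc (suc n)))
v2 = suc (suc zero)
v3 : ∀ {n} → Fin (suc (suc (suc (suc n))))
v3 = suc (suc (suc zero))

lift : ∀ {n m} → (Fin n → Fin m) → Fin (suc n) → Fin (suc m)
lift ρ zero    = zero
lift ρ (suc i) = suc (ρ i)

ren : ∀ {n m} → (Fin n → Fin m) → Fm n → Fm m
ren ρ (x ∈ᶠ y) = ρ x ∈ᶠ ρ y
ren ρ (x ≐ y)  = ρ x ≐ ρ y
ren ρ (𝒜 x)    = 𝒜 (ρ x)
ren ρ ⊥ᶠ       = ⊥ᶠ
ren ρ (φ ⇒ ψ)  = ren ρ φ ⇒ ren ρ ψ
ren ρ (∀ᶠ φ)   = ∀ᶠ (ren (lift ρ) φ)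

sub0 : ∀ {n} → Fin n → Fin (suc n) → Fin n
sub0 x zero    = x
sub0 x (suc i) = i

_[_] : ∀ {n} → Fm (suc n) → Fin n → Fm n
φ [ x ] = ren (sub0 x) φ

wk0 : ∀ {n} → Fm 0 → Fm n
wk0 = ren (λ ())

closeAll : ∀ k → Fm k → Fm 0
closeAll zero    φ = φ
closeAll (suc k) φ = closeAll k (∀ᶠ φ)

rel : ∀ {n} → Fin n → Fm n → Fm n
rel t (x ∈ᶠ y) = x ∈ᶠ y
rel t (x ≐ y)  = x ≐ y
rel t (𝒜 x)    = 𝒜 x
rel t ⊥ᶠ       = ⊥ᶠ
rel t (φ ⇒ ψ)  = rel t φ ⇒ rel t ψ
rel t (∀ᶠ φ)   = ∀ᶠ ((zero ∈ᶠ suc t) ⇒ rel (suc t) φ)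

data _⊢_ (T : Fm 0 → Set) : ∀ {n} → Fm n → Set where
  ax    : ∀ {n} {φ : Fm 0} → T φ → T ⊢ wk0 {n} φ
  K     : ∀ {n} (φ ψ : Fm n) → T ⊢ (φ ⇒ ψ ⇒ φ)
  S     : ∀ {n} (φ ψ χ : Fm n) → T ⊢ ((φ ⇒ ψ ⇒ χ) ⇒ (φ ⇒ ψ) ⇒ φ ⇒ χ)
  DNE   : ∀ {n} (φ : Fm n) → T ⊢ (¬ᶠ (¬ᶠ φ) ⇒ φ)
  MP    : ∀ {n} {φ ψ : Fm n} → T ⊢ (φ ⇒ ψ) → T ⊢ φ → T ⊢ ψ
  inst  : ∀ {n} (φ : Fm (suc n)) (x : Fin n) → T ⊢ (∀ᶠ φ ⇒ φ [ x ])
  gen   : ∀ {n} {ψ : Fm n} {φ : Fm (suc n)} →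
          T ⊢ (ren suc ψ ⇒ φ) → T ⊢ (ψ ⇒ ∀ᶠ φ)
  -- domains are nonempty: a fresh free variable may be discharged
  close : ∀ {n} {φ : Fm n} → T ⊢ ren suc φ → T ⊢ φ
  refl≐ : ∀ {n} (x : Fin n) → T ⊢ (x ≐ x)
  subst≐ : ∀ {n} (φ : Fm (suc n)) (x y : Fin n) →
           T ⊢ (x ≐ y ⇒ φ [ x ] ⇒ φ [ y ])

isSet : ∀ {n} → Fin n → Fm n
isSet x = ¬ᶠ (𝒜 x)

_⊆ᶠ_ : ∀ {n} → Fin n → Fin n → Fm n
x ⊆ᶠ t = ∀ᶠ (v0 ∈ᶠ suc x ⇒ v0 ∈ᶠ suc t)

transitive : ∀ {n} → Fin n → Fm n
transitive t = ∀ᶠ (v0 ∈ᶠ suc t ⇒ ∀ᶠ (v0 ∈ᶠ v1 ⇒ v0 ∈ᶠ suc (suc t)))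

supertransitive : ∀ {n} → Fin n → Fm n
supertransitive t =
  isSet t ∧ᶠ transitive t ∧ᶠ
  ∀ᶠ (v0 ∈ᶠ suc t ⇒
      ∀ᶠ ((isSet v0 ∧ᶠ (v0 ⊆ᶠ v1)) ⇒ v0 ∈ᶠ suc (suc t)))

Extensionality : Fm 0
Extensionality = ∀ᶠ (∀ᶠ ((isSet v0 ∧ᶠ isSet v1 ∧ᶠ ∀ᶠ (v0 ∈ᶠ v1 ⇔ᶠ v0 ∈ᶠ v2)) ⇒ v0 ≐ v1))

UrelementsEmpty : Fm 0
UrelementsEmpty = ∀ᶠ (𝒜 v0 ⇒ ∀ᶠ (¬ᶠ (v0 ∈ᶠ v1)))

Foundation : Fm 0
Foundation = ∀ᶠ (∃ᶠ (v0 ∈ᶠ v1) ⇒ ∃ᶠ (v0 ∈ᶠ v1 ∧ᶠ ¬ᶠ (∃ᶠ (v0 ∈ᶠ v1 ∧ᶠ v0 ∈ᶠ v2))))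

Pairing : Fm 0
Pairing = ∀ᶠ (∀ᶠ (∃ᶠ (isSet v0 ∧ᶠ ∀ᶠ (v0 ∈ᶠ v1 ⇔ᶠ (v0 ≐ v3 ∨ᶠ v0 ≐ v2)))))

Union : Fm 0
Union = ∀ᶠ (∃ᶠ (isSet v0 ∧ᶠ ∀ᶠ (v0 ∈ᶠ v1 ⇔ᶠ ∃ᶠ (v0 ∈ᶠ v3 ∧ᶠ v1 ∈ᶠ v0))))

Powerset : Fm 0
Powerset = ∀ᶠ (∃ᶠ (isSet v0 ∧ᶠ ∀ᶠ (v0 ∈ᶠ v1 ⇔ᶠ (isSet v0 ∧ᶠ (v0 ⊆ᶠ v2)))))

Infinity : Fm 0
Infinity =
  ∃ᶠ (isSet v0
      ∧ᶠ ∃ᶠ (v0 ∈ᶠ v1 ∧ᶠ isSet v0 ∧ᶠ ∀ᶠ (¬ᶠ (v0 ∈ᶠ v1)))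
      ∧ᶠ ∀ᶠ (v0 ∈ᶠ v1 ⇒
             ∃ᶠ (v0 ∈ᶠ v2 ∧ᶠ isSet v0 ∧ᶠ
                 ∀ᶠ (v0 ∈ᶠ v1 ⇔ᶠ (v0 ∈ᶠ v2 ∨ᶠ v0 ≐ v2)))))

-- Separation for φ(z, p₁..p_k): z = variable 0, parameters 1..k
sepρ : ∀ {k} → Fin (suc k) → Fin (3 + k)
sepρ zero    = zero
sepρ (suc i) = suc (suc (suc i))

Separation : ∀ k → Fm (suc k) → Fm 0
Separation k φ =
  closeAll k (∀ᶠ (∃ᶠ (isSet v0 ∧ᶠ ∀ᶠ (v0 ∈ᶠ v1 ⇔ᶠ (v0 ∈ᶠ v2 ∧ᶠ ren sepρ φ)))))

-- Replacement for φ(x, y, p₁..p_k): x = 0, y = 1, parameters 2..k+1: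
--   ∀p⃗ ∀w (∀x∈w ∃!y φ(x,y,p⃗) → ∃v ∀x∈w ∃y∈v φ(x,y,p⃗))
-- r1: into context [y,x,w,p⃗]; r2: into [y',y,x,w,p⃗] (φ(x,y',p⃗));
-- r3: into [y,x,v,w,p⃗]
r1 : ∀ {k} → Fin (2 + k) → Fin (3 + k)
r1 zero          = suc zero
r1 (suc zero)    = zero
r1 (suc (suc i)) = suc (suc (suc i))

r2 : ∀ {k} → Fin (2 + k) → Fin (4 + k)
r2 zero          = suc (suc zero)
r2 (suc zero)    = zero
r2 (suc (suc i)) = suc (suc (suc (suc i)))

r3 : ∀ {k} → Fin (2 + k) → Fin (4 + k)
r3 zero          = suc zero
r3 (suc zero)    = zero
r3 (suc (suc i)) = suc (suc (suc (suc i)))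

Replacement : ∀ k → Fm (2 + k) → Fm 0
Replacement k φ =
  closeAll k (∀ᶠ (
    ∀ᶠ (v0 ∈ᶠ v1 ⇒ ∃ᶠ (ren r1 φ ∧ᶠ ∀ᶠ (ren r2 φ ⇒ v0 ≐ v1)))
    ⇒ ∃ᶠ (∀ᶠ (v0 ∈ᶠ v2 ⇒ ∃ᶠ (v0 ∈ᶠ v2 ∧ᶠ ren r3 φ)))))

data ZFU : Fm 0 → Set where
  extensionality  : ZFU Extensionality
  urelementsEmpty : ZFU UrelementsEmpty
  foundation      : ZFU Foundation
  pairing         : ZFU Pairing
  union           : ZFU Union
  powerset        : ZFU Powerset
  infinity        : ZFU Infinity
  separation      : ∀ k (φ : Fm (suc k)) → ZFU (Separation k φ)
  replacement     : ∀ k (φ : Fm (2 + k)) → ZFU (Replacement k φ)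

RP : Fm 1 → Fm 0
RP φ =
  ∀ᶠ (∃ᶠ ((v1 ⊆ᶠ v0) ∧ᶠ isSet v0 ∧ᶠ transitive v0 ∧ᶠ
          ∀ᶠ (v0 ∈ᶠ v1 ⇒ (ψ ⇔ᶠ rel v1 ψ))))
  where
    ψ : Fm 3
    ψ = ren (λ _ → v0) φ

-- Collection for φ(x, y, p) (x = 0, y = 1, p = 2):
--   ∀w,p (∀x∈w ∃y φ(x,y,p) → ∃v ∀x∈w ∃y∈v φ(x,y,p))
c1 : Fin 3 → Fin 4       -- into context [y,x,p,w]
c1 zero             = v1
c1 (suc zero)       = v0
c1 (suc (suc zero)) = v2

c2 : Fin 3 → Fin 5       -- into context [y,x,v,p,w]
c2 zero             = v1
c2 (suc zero)       = v0
c2 (suc (suc zero)) = v3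

Collection : Fm 3 → Fm 0
Collection φ =
  ∀ᶠ (∀ᶠ (
    ∀ᶠ (v0 ∈ᶠ v2 ⇒ ∃ᶠ (ren c1 φ))
    ⇒ ∃ᶠ (∀ᶠ (v0 ∈ᶠ v3 ⇒ ∃ᶠ (v0 ∈ᶠ v2 ∧ᶠ ren c2 φ)))))

RP∼ : Fm 1 → Fm 0
RP∼ φ = ∀ᶠ (φ ⇒ ∃ᶠ (v1 ∈ᶠ v0 ∧ᶠ supertransitive v0 ∧ᶠ rel v0 (ren (λ _ → v1) φ)))

data ZFU+RP : Fm 0 → Set where
  zfu : ∀ {φ} → ZFU φ → ZFU+RP φ
  rp  : ∀ φ → ZFU+RP (RP φ)

-- RP is never applied to the formula of interest directly but to a formula Θ coding a binary
-- formula Φ: Θ(v) says that ordered pairs exist and that v is either empty or a pair (a, b) with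
-- Φ(a, b). Since Θ holds at an empty set, a transitive set t that contains one and reflects Θ also
-- reflects "ordered pairs exist"; so t is closed under pairs, and then it reflects Φ at all a, b ∈ t.
--
-- Collection: take for a the pair (x, p) and let Φ(a, b) say ∃y φ(x, y, p) when b is empty and
-- φ(x, y, p) when b = (y, y). If t contains w and p, every x ∈ w gets a witness y ∈ t from the first
-- clause reflected into t, and φ(x, y, p) holds by the second clause reflected back out of t.
--
-- RP∼: let Φ(a, b) say φ(b) and Powerset when a is empty, and "a contains every subset of b"
-- otherwise. A reflecting t containing x satisfies φ(x) and Powerset. The P ∈ t that t believes to
-- contain every subset of y ∈ t contains the empty set, so it is nonempty and the second clause
-- carries that belief out of t: every subset of y lies in P ⊆ t.

module Submission where

open import Defs
open import Data.Nat using (ℕ; zero; suc; _+_)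
open import Data.Fin using (Fin; zero; suc)
open import Data.Vec using (Vec; []; _∷_; lookup; map)
open import Data.Vec.Properties using (lookup-map)
open import Data.Product using (_×_; _,_)
open import Function using (_∘_; id)
open import Relation.Binary.PropositionalEquality
  using (_≡_; _≗_; refl; sym; trans; cong; cong₂; subst; subst₂)

lift-cong : ∀ {n m} {ρ σ : Fin n → Fin m} → ρ ≗ σ → lift ρ ≗ lift σ
lift-cong h zero    = refl
lift-cong h (suc i) = cong suc (h i)

ren-cong : ∀ {n m} {ρ σ : Fin n → Fin m} → ρ ≗ σ → ren ρ ≗ ren σ
ren-cong h (x ∈ᶠ y) = cong₂ _∈ᶠ_ (h x) (h y)
ren-cong h (x ≐ y)  = cong₂ _≐_ (h x) (h y)
ren-cong h (𝒜 x)    = cong 𝒜 (h x)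
ren-cong h ⊥ᶠ       = refl
ren-cong h (φ ⇒ ψ)  = cong₂ _⇒_ (ren-cong h φ) (ren-cong h ψ)
ren-cong h (∀ᶠ φ)   = cong ∀ᶠ (ren-cong (lift-cong h) φ)

lift-∘ : ∀ {n m k} (ρ : Fin m → Fin k) (σ : Fin n → Fin m) → lift ρ ∘ lift σ ≗ lift (ρ ∘ σ)
lift-∘ ρ σ zero    = refl
lift-∘ ρ σ (suc i) = refl

ren-∘ : ∀ {n m k} (ρ : Fin m → Fin k) (σ : Fin n → Fin m) φ → ren ρ (ren σ φ) ≡ ren (ρ ∘ σ) φ
ren-∘ ρ σ (x ∈ᶠ y) = refl
ren-∘ ρ σ (x ≐ y)  = refl
ren-∘ ρ σ (𝒜 x)    = refl
ren-∘ ρ σ ⊥ᶠ       = refl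
ren-∘ ρ σ (φ ⇒ ψ)  = cong₂ _⇒_ (ren-∘ ρ σ φ) (ren-∘ ρ σ ψ)
ren-∘ ρ σ (∀ᶠ φ)   = cong ∀ᶠ (trans (ren-∘ (lift ρ) (lift σ) φ) (ren-cong (lift-∘ ρ σ) φ))

ren-∘-cong : ∀ {n m k} {ρ : Fin m → Fin k} {σ : Fin n → Fin m} {τ : Fin n → Fin k} →
             ρ ∘ σ ≗ τ → ∀ φ → ren ρ (ren σ φ) ≡ ren τ φ
ren-∘-cong h φ = trans (ren-∘ _ _ φ) (ren-cong h φ)

ren-id : ∀ {n} {ρ : Fin n → Fin n} → ρ ≗ id → ∀ φ → ren ρ φ ≡ φ
ren-id h (x ∈ᶠ y) = cong₂ _∈ᶠ_ (h x) (h y)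
ren-id h (x ≐ y)  = cong₂ _≐_ (h x) (h y)
ren-id h (𝒜 x)    = cong 𝒜 (h x)
ren-id h ⊥ᶠ       = refl
ren-id h (φ ⇒ ψ)  = cong₂ _⇒_ (ren-id h φ) (ren-id h ψ)
ren-id h (∀ᶠ φ)   = cong ∀ᶠ (ren-id (λ { zero → refl ; (suc i) → cong suc (h i) }) φ)

ren-rel : ∀ {n m} (ρ : Fin n → Fin m) t φ → ren ρ (rel t φ) ≡ rel (ρ t) (ren ρ φ)
ren-rel ρ t (x ∈ᶠ y) = refl
ren-rel ρ t (x ≐ y)  = refl
ren-rel ρ t (𝒜 x)    = refl
ren-rel ρ t ⊥ᶠ       = refl
ren-rel ρ t (φ ⇒ ψ)  = cong₂ _⇒_ (ren-rel ρ t φ) (ren-rel ρ t ψ)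
ren-rel ρ t (∀ᶠ φ)   = cong (λ ψ → ∀ᶠ (zero ∈ᶠ suc (ρ t) ⇒ ψ)) (ren-rel (lift ρ) (suc t) φ)

sub0-lift-suc : ∀ {n} → sub0 {suc n} zero ∘ lift suc ≗ id
sub0-lift-suc zero    = refl
sub0-lift-suc (suc i) = refl

ren-lift-suc-[0] : ∀ {n} (φ : Fm (suc n)) → ren (lift suc) φ [ zero ] ≡ φ
ren-lift-suc-[0] φ = trans (ren-∘ (sub0 zero) (lift suc) φ) (ren-id sub0-lift-suc φ)

sub0-lift : ∀ {n m} (ρ : Fin n → Fin m) x → sub0 (ρ x) ∘ lift ρ ≗ ρ ∘ sub0 x
sub0-lift ρ x zero    = refl
sub0-lift ρ x (suc i) = refl

ren-sub0 : ∀ {n m} (ρ : Fin n → Fin m) x φ → ren (lift ρ) φ [ ρ x ] ≡ ren ρ (φ [ x ])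
ren-sub0 ρ x φ = trans (ren-∘-cong (sub0-lift ρ x) φ) (sym (ren-∘ ρ (sub0 x) φ))

ren-lift-suc : ∀ {n m} (ρ : Fin n → Fin m) φ → ren (lift ρ) (ren suc φ) ≡ ren suc (ren ρ φ)
ren-lift-suc ρ φ = trans (ren-∘ (lift ρ) suc φ) (sym (ren-∘ suc ρ φ))

infix 8 _⟨_⟩
-- Opaque so that instances at concrete formulas are not unfolded by the type checker.
opaque
  _⟨_⟩ : ∀ {k n} → Fm k → Vec (Fin n) k → Fm n
  φ ⟨ xs ⟩ = ren (lookup xs) φ

  ⟨⟩-as-ren : ∀ {k n} (φ : Fm k) (xs : Vec (Fin n) k) → φ ⟨ xs ⟩ ≡ ren (lookup xs) φ
  ⟨⟩-as-ren φ xs = refl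

ren-as-⟨⟩ : ∀ {k n} {ρ : Fin k → Fin n} {xs : Vec (Fin n) k} → ρ ≗ lookup xs → ∀ φ → ren ρ φ ≡ φ ⟨ xs ⟩
ren-as-⟨⟩ {xs = xs} h φ = trans (ren-cong h φ) (sym (⟨⟩-as-ren φ xs))

ren-⟨⟩ : ∀ {k n m} (σ : Fin n → Fin m) (xs : Vec (Fin n) k) φ → ren σ (φ ⟨ xs ⟩) ≡ φ ⟨ map σ xs ⟩
ren-⟨⟩ σ xs φ = trans (cong (ren σ) (⟨⟩-as-ren φ xs))
                      (trans (ren-∘ σ (lookup xs) φ) (ren-as-⟨⟩ (λ i → sym (lookup-map i σ xs)) φ))

ren-rel-⟨⟩ : ∀ {k n m} (σ : Fin n → Fin m) t (xs : Vec (Fin n) k) φ →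
             ren σ (rel t (φ ⟨ xs ⟩)) ≡ rel (σ t) (φ ⟨ map σ xs ⟩)
ren-rel-⟨⟩ σ t xs φ = trans (ren-rel σ t _) (cong (rel (σ t)) (ren-⟨⟩ σ xs φ))

ren²-⟨⟩ : ∀ {k n m l} (σ : Fin m → Fin l) (τ : Fin n → Fin m) (xs : Vec (Fin n) k) φ →
          ren σ (ren τ (φ ⟨ xs ⟩)) ≡ φ ⟨ map σ (map τ xs) ⟩
ren²-⟨⟩ σ τ xs φ = trans (cong (ren σ) (ren-⟨⟩ τ xs φ)) (ren-⟨⟩ σ (map τ xs) φ)

ren²-rel-⟨⟩ : ∀ {k n m l} (σ : Fin m → Fin l) (τ : Fin n → Fin m) t (xs : Vec (Fin n) k) φ →
              ren σ (ren τ (rel t (φ ⟨ xs ⟩))) ≡ rel (σ (τ t)) (φ ⟨ map σ (map τ xs) ⟩)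
ren²-rel-⟨⟩ σ τ t xs φ = trans (cong (ren σ) (ren-rel-⟨⟩ τ t xs φ)) (ren-rel-⟨⟩ σ (τ t) (map τ xs) φ)

module NaturalDeduction (T : Fm 0 → Set) where

  ⊢-ren : ∀ {n m} (ρ : Fin n → Fin m) {φ : Fm n} → T ⊢ φ → T ⊢ ren ρ φ
  ⊢-ren ρ (ax {φ = ψ} t)   = subst (T ⊢_) (sym (ren-∘-cong (λ ()) ψ)) (ax t)
  ⊢-ren ρ (K φ ψ)          = K _ _
  ⊢-ren ρ (S φ ψ χ)        = S _ _ _
  ⊢-ren ρ (DNE φ)          = DNE _
  ⊢-ren ρ (MP d e)         = MP (⊢-ren ρ d) (⊢-ren ρ e)
  ⊢-ren ρ (inst φ x)       =
    subst (λ ψ → T ⊢ (∀ᶠ (ren (lift ρ) φ) ⇒ ψ)) (ren-sub0 ρ x φ) (inst (ren (lift ρ) φ) (ρ x))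
  ⊢-ren ρ (gen {ψ = ψ} {φ} d) =
    gen (subst (λ χ → T ⊢ (χ ⇒ ren (lift ρ) φ)) (ren-lift-suc ρ ψ) (⊢-ren (lift ρ) d))
  ⊢-ren ρ (close {φ = φ} d) = close (subst (T ⊢_) (ren-lift-suc ρ φ) (⊢-ren (lift ρ) d))
  ⊢-ren ρ (refl≐ x)        = refl≐ _
  ⊢-ren ρ (subst≐ φ x y)   =
    subst₂ (λ ψ χ → T ⊢ (ρ x ≐ ρ y ⇒ ψ ⇒ χ)) (ren-sub0 ρ x φ) (ren-sub0 ρ y φ)
           (subst≐ (ren (lift ρ) φ) (ρ x) (ρ y))

  infixl 4 _▸_
  data Ctx (n : ℕ) : Set where
    ε   : Ctx n
    _▸_ : Ctx n → Fm n → Ctx n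

  ⟦_⟧ : ∀ {n} → Ctx n → Fm n → Fm n
  ⟦ ε ⟧     φ = φ
  ⟦ Γ ▸ ψ ⟧ φ = ⟦ Γ ⟧ (ψ ⇒ φ)

  renCtx : ∀ {n m} → (Fin n → Fin m) → Ctx n → Ctx m
  renCtx ρ ε       = ε
  renCtx ρ (Γ ▸ ψ) = renCtx ρ Γ ▸ ren ρ ψ

  ren-⟦⟧ : ∀ {n m} (ρ : Fin n → Fin m) Γ φ → ren ρ (⟦ Γ ⟧ φ) ≡ ⟦ renCtx ρ Γ ⟧ (ren ρ φ)
  ren-⟦⟧ ρ ε       φ = refl
  ren-⟦⟧ ρ (Γ ▸ ψ) φ = ren-⟦⟧ ρ Γ (ψ ⇒ φ)

  infix 2 _⊩_
  record _⊩_ {n} (Γ : Ctx n) (φ : Fm n) : Set where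
    constructor deduction
    field derivation : T ⊢ ⟦ Γ ⟧ φ
  open _⊩_ public

  infix 3 _∋_
  data _∋_ {n} : Ctx n → Fm n → Set where
    here  : ∀ {Γ φ} → Γ ▸ φ ∋ φ
    there : ∀ {Γ φ ψ} → Γ ∋ φ → Γ ▸ ψ ∋ φ

  ⊢-id : ∀ {n} (φ : Fm n) → T ⊢ (φ ⇒ φ)
  ⊢-id φ = MP (MP (S φ (φ ⇒ φ) φ) (K φ (φ ⇒ φ))) (K φ φ)

  ⊢-const : ∀ {n} (Γ : Ctx n) {φ} → T ⊢ φ → T ⊢ ⟦ Γ ⟧ φ
  ⊢-const ε       d = d
  ⊢-const (Γ ▸ ψ) d = ⊢-const Γ (MP (K _ ψ) d)

  ⊢-MP : ∀ {n} (Γ : Ctx n) {φ ψ} → T ⊢ ⟦ Γ ⟧ (φ ⇒ ψ) → T ⊢ ⟦ Γ ⟧ φ → T ⊢ ⟦ Γ ⟧ ψ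
  ⊢-MP ε       d e = MP d e
  ⊢-MP (Γ ▸ χ) d e = ⊢-MP Γ (⊢-MP Γ (⊢-const Γ (S χ _ _)) d) e

  weaken : ∀ {n} {Γ : Ctx n} {φ ψ} → Γ ⊩ φ → Γ ▸ ψ ⊩ φ
  weaken {Γ = Γ} (deduction d) = deduction (⊢-MP Γ (⊢-const Γ (K _ _)) d)

  assumption : ∀ {n} {Γ : Ctx n} {φ} → Γ ∋ φ → Γ ⊩ φ
  assumption {Γ = Γ ▸ φ} here      = deduction (⊢-const Γ (⊢-id φ))
  assumption {Γ = Γ ▸ ψ} (there p) = weaken (assumption p)

  h0 : ∀ {n} {Γ : Ctx n} {φ} → Γ ▸ φ ⊩ φ
  h0 = assumption here

  h1 : ∀ {n} {Γ : Ctx n} {φ ψ} → Γ ▸ φ ▸ ψ ⊩ φ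
  h1 = assumption (there here)

  theorem : ∀ {n} {Γ : Ctx n} {φ} → T ⊢ φ → Γ ⊩ φ
  theorem {Γ = Γ} d = deduction (⊢-const Γ d)

  ⇒I : ∀ {n} {Γ : Ctx n} {φ ψ} → Γ ▸ φ ⊩ ψ → Γ ⊩ φ ⇒ ψ
  ⇒I (deduction d) = deduction d

  ⇒E : ∀ {n} {Γ : Ctx n} {φ ψ} → Γ ⊩ φ ⇒ ψ → Γ ⊩ φ → Γ ⊩ ψ
  ⇒E {Γ = Γ} (deduction d) (deduction e) = deduction (⊢-MP Γ d e)

  ⊩-ren : ∀ {n m} (ρ : Fin n → Fin m) {Γ : Ctx n} {φ} → Γ ⊩ φ → renCtx ρ Γ ⊩ ren ρ φ
  ⊩-ren ρ {Γ} {φ} (deduction d) = deduction (subst (T ⊢_) (ren-⟦⟧ ρ Γ φ) (⊢-ren ρ d))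

  ↑ : ∀ {n} {Γ : Ctx n} {φ ψ} → Γ ⊩ φ → renCtx suc Γ ▸ ψ ⊩ ren suc φ
  ↑ d = weaken (⊩-ren suc d)

  ↑↑ : ∀ {n} {Γ : Ctx n} {φ ψ χ} → Γ ⊩ φ → renCtx suc Γ ▸ ψ ▸ χ ⊩ ren suc φ
  ↑↑ d = weaken (↑ d)

  cast : ∀ {n} {Γ : Ctx n} {φ ψ} → φ ≡ ψ → Γ ⊩ φ → Γ ⊩ ψ
  cast refl d = d

  ¬¬E : ∀ {n} {Γ : Ctx n} {φ} → Γ ⊩ ¬ᶠ (¬ᶠ φ) → Γ ⊩ φ
  ¬¬E d = ⇒E (theorem (DNE _)) d

  ⊥E : ∀ {n} {Γ : Ctx n} {φ} → Γ ⊩ ⊥ᶠ → Γ ⊩ φ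
  ⊥E d = ¬¬E (⇒I (weaken d))

  contradiction : ∀ {n} {Γ : Ctx n} {φ ψ} → Γ ⊩ φ → Γ ⊩ ¬ᶠ φ → Γ ⊩ ψ
  contradiction d e = ⊥E (⇒E e d)

  ∧I : ∀ {n} {Γ : Ctx n} {φ ψ} → Γ ⊩ φ → Γ ⊩ ψ → Γ ⊩ φ ∧ᶠ ψ
  ∧I d e = ⇒I (⇒E (⇒E h0 (weaken d)) (weaken e))

  ∧E₁ : ∀ {n} {Γ : Ctx n} {φ ψ} → Γ ⊩ φ ∧ᶠ ψ → Γ ⊩ φ
  ∧E₁ d = ¬¬E (⇒I (⇒E (weaken d) (⇒I (contradiction h0 h1))))

  ∧E₂ : ∀ {n} {Γ : Ctx n} {φ ψ} → Γ ⊩ φ ∧ᶠ ψ → Γ ⊩ ψ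
  ∧E₂ d = ¬¬E (⇒I (⇒E (weaken d) (⇒I (weaken h0))))

  ∨I₁ : ∀ {n} {Γ : Ctx n} {φ ψ} → Γ ⊩ φ → Γ ⊩ φ ∨ᶠ ψ
  ∨I₁ d = ⇒I (contradiction (weaken d) h0)

  ∨I₂ : ∀ {n} {Γ : Ctx n} {φ ψ} → Γ ⊩ ψ → Γ ⊩ φ ∨ᶠ ψ
  ∨I₂ d = ⇒I (weaken d)

  ∨E : ∀ {n} {Γ : Ctx n} {φ ψ χ} → Γ ⊩ φ ∨ᶠ ψ → Γ ▸ φ ⊩ χ → Γ ▸ ψ ⊩ χ → Γ ⊩ χ
  ∨E {Γ = Γ} {φ} {χ = χ} d e f = ¬¬E (⇒I (⇒E h0 (⇒E (weaken (⇒I f)) (⇒E (weaken d) notφ))))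
    where
    notφ : Γ ▸ ¬ᶠ χ ⊩ ¬ᶠ φ
    notφ = ⇒I (⇒E h1 (⇒E (weaken (weaken (⇒I e))) h0))

  ⇔I : ∀ {n} {Γ : Ctx n} {φ ψ} → Γ ▸ φ ⊩ ψ → Γ ▸ ψ ⊩ φ → Γ ⊩ φ ⇔ᶠ ψ
  ⇔I d e = ∧I (⇒I d) (⇒I e)

  ⇔E₁ : ∀ {n} {Γ : Ctx n} {φ ψ} → Γ ⊩ φ ⇔ᶠ ψ → Γ ⊩ φ → Γ ⊩ ψ
  ⇔E₁ d = ⇒E (∧E₁ d)

  ⇔E₂ : ∀ {n} {Γ : Ctx n} {φ ψ} → Γ ⊩ φ ⇔ᶠ ψ → Γ ⊩ ψ → Γ ⊩ φ
  ⇔E₂ d = ⇒E (∧E₂ d)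

  ∀E : ∀ {n} {Γ : Ctx n} {φ} (x : Fin n) → Γ ⊩ ∀ᶠ φ → Γ ⊩ φ [ x ]
  ∀E x = ⇒E (theorem (inst _ x))

  private
    ∀-pull : ∀ {n} (χ : Fm n) (φ : Fm (suc n)) → T ⊢ (∀ᶠ (ren suc χ ⇒ φ) ⇒ χ ⇒ ∀ᶠ φ)
    ∀-pull χ φ = derivation {Γ = ε} (⇒I (⇒I (⇒E (theorem (gen (derivation (⇒I body)))) (∧I h1 h0))))
      where
      body : ε ▸ ren suc (∀ᶠ (ren suc χ ⇒ φ) ∧ᶠ χ) ⊩ φ
      body = ⇒E (cast (cong₂ _⇒_ (ren-lift-suc-[0] (ren suc χ)) (ren-lift-suc-[0] φ)) (∀E zero (∧E₁ h0))) (∧E₂ h0)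

  ∀I : ∀ {n} {Γ : Ctx n} {φ} → renCtx suc Γ ⊩ φ → Γ ⊩ ∀ᶠ φ
  ∀I {Γ = ε}     (deduction d) = deduction (MP (gen (MP (K _ (⊥ᶠ ⇒ ⊥ᶠ)) d)) (⊢-id ⊥ᶠ))
  ∀I {Γ = Γ ▸ χ} (deduction d) = deduction (derivation (⇒E (theorem (∀-pull χ _)) (∀I {Γ = Γ} (deduction d))))

  ∃I : ∀ {n} {Γ : Ctx n} {φ} (x : Fin n) → Γ ⊩ φ [ x ] → Γ ⊩ ∃ᶠ φ
  ∃I x d = ⇒I (⇒E (∀E x h0) (weaken d))

  ∃E : ∀ {n} {Γ : Ctx n} {φ ψ} → Γ ⊩ ∃ᶠ φ → renCtx suc Γ ▸ φ ⊩ ren suc ψ → Γ ⊩ ψ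
  ∃E d e = ¬¬E (⇒I (⇒E (weaken d) (∀I (⇒I (⇒E h1 (⇒E (weaken (weaken (⇒I e))) h0))))))

  ∃∈ : ∀ {n} → Fin n → Fm (suc n) → Fm n
  ∃∈ t φ = ¬ᶠ (∀ᶠ (zero ∈ᶠ suc t ⇒ ¬ᶠ φ))

  ∃∈I : ∀ {n} {Γ : Ctx n} {t φ} (x : Fin n) → Γ ⊩ x ∈ᶠ t → Γ ⊩ φ [ x ] → Γ ⊩ ∃∈ t φ
  ∃∈I x x∈t d = ⇒I (⇒E (⇒E (∀E x h0) (weaken x∈t)) (weaken d))

  ∃∈E : ∀ {n} {Γ : Ctx n} {t φ ψ} → Γ ⊩ ∃∈ t φ → renCtx suc Γ ▸ zero ∈ᶠ suc t ▸ φ ⊩ ren suc ψ → Γ ⊩ ψ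
  ∃∈E d e = ¬¬E (⇒I (⇒E (weaken d) (∀I (⇒I (⇒I (⇒E (assumption (there (there here)))
                  (⇒E (⇒E (weaken (weaken (weaken (⇒I (⇒I e))))) h1) h0)))))))

  ≐-refl : ∀ {n} {Γ : Ctx n} (x : Fin n) → Γ ⊩ x ≐ x
  ≐-refl x = theorem (refl≐ x)

  ≐-subst : ∀ {n} {Γ : Ctx n} (φ : Fm (suc n)) {x y : Fin n} → Γ ⊩ x ≐ y → Γ ⊩ φ [ x ] → Γ ⊩ φ [ y ]
  ≐-subst φ {x} {y} e = ⇒E (⇒E (theorem (subst≐ φ x y)) e)

  ≐-sym : ∀ {n} {Γ : Ctx n} {x y : Fin n} → Γ ⊩ x ≐ y → Γ ⊩ y ≐ x
  ≐-sym {x = x} e = ≐-subst (zero ≐ suc x) e (≐-refl x)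

  ≐-trans : ∀ {n} {Γ : Ctx n} {x y z : Fin n} → Γ ⊩ x ≐ y → Γ ⊩ y ≐ z → Γ ⊩ x ≐ z
  ≐-trans {x = x} e f = ≐-subst (suc x ≐ zero) f e

  ren-≐-cong : ∀ {k n} (φ : Fm k) {Γ : Ctx n} (ρ σ : Fin k → Fin n) →
               (∀ i → Γ ⊩ ρ i ≐ σ i) → Γ ⊩ ren ρ φ ⇒ ren σ φ
  ren-≐-cong (x ∈ᶠ y) ρ σ h =
    ⇒I (≐-subst (suc (σ x) ∈ᶠ zero) (weaken (h y)) (≐-subst (zero ∈ᶠ suc (ρ y)) (weaken (h x)) h0))
  ren-≐-cong (x ≐ y) ρ σ h =
    ⇒I (≐-subst (suc (σ x) ≐ zero) (weaken (h y)) (≐-subst (zero ≐ suc (ρ y)) (weaken (h x)) h0))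
  ren-≐-cong (𝒜 x) ρ σ h = ⇒I (≐-subst (𝒜 zero) (weaken (h x)) h0)
  ren-≐-cong ⊥ᶠ ρ σ h = ⇒I h0
  ren-≐-cong (φ ⇒ ψ) ρ σ h =
    ⇒I (⇒I (⇒E (weaken (weaken (ren-≐-cong ψ ρ σ h)))
               (⇒E h1 (⇒E (weaken (weaken (ren-≐-cong φ σ ρ (λ i → ≐-sym (h i))))) h0))))
  ren-≐-cong (∀ᶠ φ) {Γ} ρ σ h =
    ⇒I (∀I (⇒E (ren-≐-cong φ (lift ρ) (lift σ) lifted) (cast (ren-lift-suc-[0] _) (∀E zero h0))))
    where
    lifted : ∀ i → renCtx suc (Γ ▸ ∀ᶠ (ren (lift ρ) φ)) ⊩ lift ρ i ≐ lift σ i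
    lifted zero    = ≐-refl zero
    lifted (suc i) = ↑ (h i)

  ⟨⟩-cong : ∀ {k n} {Γ : Ctx n} (φ : Fm k) {xs ys : Vec (Fin n) k} →
            (∀ i → Γ ⊩ lookup xs i ≐ lookup ys i) → Γ ⊩ φ ⟨ xs ⟩ → Γ ⊩ φ ⟨ ys ⟩
  ⟨⟩-cong φ {xs} {ys} h d =
    cast (sym (⟨⟩-as-ren φ ys)) (⇒E (ren-≐-cong φ (lookup xs) (lookup ys) h) (cast (⟨⟩-as-ren φ xs) d))

  rel-⟨⟩-cong : ∀ {k n} {Γ : Ctx n} (φ : Fm k) {t} {xs ys : Vec (Fin n) k} →
                (∀ i → Γ ⊩ lookup xs i ≐ lookup ys i) → Γ ⊩ rel t (φ ⟨ xs ⟩) → Γ ⊩ rel t (φ ⟨ ys ⟩)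
  rel-⟨⟩-cong {Γ = Γ} φ {t} {xs} {ys} h d =
    cast (as-⟨⟩ ys) (⟨⟩-cong (rel zero (ren suc φ)) {t ∷ xs} {t ∷ ys} h' (cast (sym (as-⟨⟩ xs)) d))
    where
    as-⟨⟩ : ∀ zs → rel zero (ren suc φ) ⟨ t ∷ zs ⟩ ≡ rel t (φ ⟨ zs ⟩)
    as-⟨⟩ zs = trans (⟨⟩-as-ren (rel zero (ren suc φ)) (t ∷ zs))
                     (trans (ren-rel (lookup (t ∷ zs)) zero (ren suc φ))
                            (cong (rel t) (trans (ren-∘ (lookup (t ∷ zs)) suc φ) (ren-as-⟨⟩ (λ _ → refl) φ))))
    h' : ∀ i → Γ ⊩ lookup (t ∷ xs) i ≐ lookup (t ∷ ys) i
    h' zero    = ≐-refl t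
    h' (suc i) = h i

open NaturalDeduction ZFU+RP

-- Ordered pairs and their absoluteness

IsUPair : ∀ {n} → Fin n → Fin n → Fin n → Fm n
IsUPair c a b = ∀ᶠ (zero ∈ᶠ suc c ⇔ᶠ (zero ≐ suc a ∨ᶠ zero ≐ suc b))

IsSingleton : ∀ {n} → Fin n → Fin n → Fm n
IsSingleton s a = a ∈ᶠ s ∧ᶠ ∀ᶠ (zero ∈ᶠ suc s ⇒ zero ≐ suc a)

IsDoubleton : ∀ {n} → Fin n → Fin n → Fin n → Fm n
IsDoubleton s a b = a ∈ᶠ s ∧ᶠ b ∈ᶠ s ∧ᶠ ∀ᶠ (zero ∈ᶠ suc s ⇒ (zero ≐ suc a ∨ᶠ zero ≐ suc b))

-- A Kuratowski pair described by membership alone: without Extensionality the set v is not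
-- determined by a and b, but a and b are determined by v, which is all that is used.
IsOrdPair : ∀ {n} → Fin n → Fin n → Fin n → Fm n
IsOrdPair v a b = ∃ᶠ (zero ∈ᶠ suc v ∧ᶠ IsSingleton zero (suc a))
               ∧ᶠ ∃ᶠ (zero ∈ᶠ suc v ∧ᶠ IsDoubleton zero (suc a) (suc b))
               ∧ᶠ ∀ᶠ (zero ∈ᶠ suc v ⇒ (IsSingleton zero (suc a) ∨ᶠ IsDoubleton zero (suc a) (suc b)))

Empty : ∀ {n} → Fin n → Fm n
Empty e = ∀ᶠ (¬ᶠ (zero ∈ᶠ suc e))

PairsExist : ∀ {n} → Fm n
PairsExist = ∀ᶠ (∀ᶠ (∃ᶠ (IsOrdPair zero v2 v1)))

ClosedUnderPairs : ∀ {n} → Fin n → Fm n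
ClosedUnderPairs t = ∀ᶠ (zero ∈ᶠ suc t ⇒ ∀ᶠ (zero ∈ᶠ suc (suc t) ⇒
                       ∃ᶠ (zero ∈ᶠ suc (suc (suc t)) ∧ᶠ IsOrdPair zero v2 v1)))

upair-exists : ∀ {n} {Γ : Ctx n} (a b : Fin n) → Γ ⊩ ∃ᶠ (IsUPair zero (suc a) (suc b))
upair-exists a b = ∃E (∀E b (∀E a (theorem (ax (zfu pairing))))) (∃I zero (∧E₂ h0))

upair-∈₁ : ∀ {n} {Γ : Ctx n} {c a b : Fin n} → Γ ⊩ IsUPair c a b → Γ ⊩ a ∈ᶠ c
upair-∈₁ {a = a} c = ⇔E₂ (∀E a c) (∨I₁ (≐-refl a))

upair-∈₂ : ∀ {n} {Γ : Ctx n} {c a b : Fin n} → Γ ⊩ IsUPair c a b → Γ ⊩ b ∈ᶠ c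
upair-∈₂ {b = b} c = ⇔E₂ (∀E b c) (∨I₂ (≐-refl b))

⊆-∈ : ∀ {n} {Γ : Ctx n} {x t y : Fin n} → Γ ⊩ x ⊆ᶠ t → Γ ⊩ y ∈ᶠ x → Γ ⊩ y ∈ᶠ t
⊆-∈ {y = y} x⊆t = ⇒E (∀E y x⊆t)

transitive-∈ : ∀ {n} {Γ : Ctx n} {t y z : Fin n} → Γ ⊩ transitive t → Γ ⊩ y ∈ᶠ t → Γ ⊩ z ∈ᶠ y → Γ ⊩ z ∈ᶠ t
transitive-∈ {y = y} {z} tr y∈t = ⇒E (∀E z (⇒E (∀E y tr) y∈t))

upair⇒singleton : ∀ {n} {Γ : Ctx n} {s a : Fin n} → Γ ⊩ IsUPair s a a → Γ ⊩ IsSingleton s a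
upair⇒singleton c = ∧I (upair-∈₁ c) (∀I (⇒I (∨E (⇔E₁ (∀E zero (↑ c)) h0) h0 h0)))

upair⇒doubleton : ∀ {n} {Γ : Ctx n} {s a b : Fin n} → Γ ⊩ IsUPair s a b → Γ ⊩ IsDoubleton s a b
upair⇒doubleton c = ∧I (upair-∈₁ c) (∧I (upair-∈₂ c) (∀I (⇒I (⇔E₁ (∀E zero (↑ c)) h0))))

upair⇒ordPair : ∀ {n} {Γ : Ctx n} {v s d a b : Fin n} →
                Γ ⊩ IsUPair v s d → Γ ⊩ IsSingleton s a → Γ ⊩ IsDoubleton d a b → Γ ⊩ IsOrdPair v a b
upair⇒ordPair {a = a} {b} c sa dab =
  ∧I (∃I _ (∧I (upair-∈₁ c) sa))
  (∧I (∃I _ (∧I (upair-∈₂ c) dab))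
  (∀I (⇒I (∨E (⇔E₁ (∀E zero (↑ c)) h0)
     (∨I₁ (≐-subst (IsSingleton zero (suc (suc a))) (≐-sym h0) (↑↑ sa)))
     (∨I₂ (≐-subst (IsDoubleton zero (suc (suc a)) (suc (suc b))) (≐-sym h0) (↑↑ dab)))))))

ordPair-exists : ∀ {n} {Γ : Ctx n} (a b : Fin n) → Γ ⊩ ∃ᶠ (IsOrdPair zero (suc a) (suc b))
ordPair-exists a b =
  ∃E (upair-exists a a) (
  ∃E (upair-exists (suc a) (suc b)) (
  ∃E (upair-exists v1 v0) (
  ∃I zero (upair⇒ordPair h0 (↑ (↑ (upair⇒singleton h0))) (↑ (upair⇒doubleton h0))))))

pairsExist : ∀ {n} {Γ : Ctx n} → Γ ⊩ PairsExist
pairsExist = ∀I (∀I (ordPair-exists v1 v0))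

empty-exists : ∀ {n} {Γ : Ctx n} → Γ ⊩ ∃ᶠ (isSet zero ∧ᶠ Empty zero)
empty-exists = ∃E (theorem (ax (zfu infinity))) (∃E (∧E₁ (∧E₂ h0)) (∃I zero (∧E₂ h0)))

singleton-≐ : ∀ {n} {Γ : Ctx n} {s a z : Fin n} → Γ ⊩ IsSingleton s a → Γ ⊩ z ∈ᶠ s → Γ ⊩ z ≐ a
singleton-≐ {z = z} sa = ⇒E (∀E z (∧E₂ sa))

doubleton-≐ : ∀ {n} {Γ : Ctx n} {s a b z : Fin n} → Γ ⊩ IsDoubleton s a b → Γ ⊩ z ∈ᶠ s → Γ ⊩ z ≐ a ∨ᶠ z ≐ b
doubleton-≐ {z = z} dab = ⇒E (∀E z (∧E₂ (∧E₂ dab)))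

doubleton-∈₂ : ∀ {n} {Γ : Ctx n} {s a b : Fin n} → Γ ⊩ IsDoubleton s a b → Γ ⊩ b ∈ᶠ s
doubleton-∈₂ dab = ∧E₁ (∧E₂ dab)

ordPair-∈ : ∀ {n} {Γ : Ctx n} {v a b s : Fin n} → Γ ⊩ IsOrdPair v a b → Γ ⊩ s ∈ᶠ v →
            Γ ⊩ IsSingleton s a ∨ᶠ IsDoubleton s a b
ordPair-∈ {s = s} p = ⇒E (∀E s (∧E₂ (∧E₂ p)))

ordPair-inj₁ : ∀ {n} {Γ : Ctx n} {v a b a' b' : Fin n} →
               Γ ⊩ IsOrdPair v a b → Γ ⊩ IsOrdPair v a' b' → Γ ⊩ a ≐ a'
ordPair-inj₁ p p' = ∃E (∧E₁ p') (
  ∨E (ordPair-∈ (↑ p) (∧E₁ h0))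
     (≐-sym (singleton-≐ h0 (weaken (∧E₁ (∧E₂ h0)))))
     (singleton-≐ (weaken (∧E₂ h0)) (∧E₁ h0)))

doubleton-inj₂ : ∀ {n} {Γ : Ctx n} {s a b a' b' : Fin n} →
                 Γ ⊩ IsDoubleton s a b → Γ ⊩ IsDoubleton s a' b' → Γ ⊩ a ≐ a' → Γ ⊩ b ≐ b'
doubleton-inj₂ dab dab' a≐a' =
  ∨E (doubleton-≐ dab (doubleton-∈₂ dab'))
     (∨E (doubleton-≐ (weaken dab') (doubleton-∈₂ (weaken dab)))
         (≐-trans h0 (≐-trans (≐-sym (weaken (weaken a≐a'))) (≐-sym h1)))
         h0)
     (≐-sym h0)

-- Here {a} = {a', b'} forces b' = a; compare the member {a, b} of v with the second pair.
ordPair-inj₂-singleton : ∀ {n} {Γ : Ctx n} {v s a b a' b' : Fin n} →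
                         Γ ⊩ IsOrdPair v a b → Γ ⊩ IsOrdPair v a' b' → Γ ⊩ a ≐ a' →
                         Γ ⊩ IsSingleton s a → Γ ⊩ IsDoubleton s a' b' → Γ ⊩ b ≐ b'
ordPair-inj₂-singleton {Γ = Γ} {a = a} {b' = b'} p p' a≐a' sa dab' = ∃E (∧E₁ (∧E₂ p)) (
  ∨E (ordPair-∈ (↑ p') (∧E₁ h0))
     (≐-trans (singleton-≐ h0 (doubleton-∈₂ (weaken (∧E₂ h0))))
              (≐-trans (≐-sym (↑↑ a≐a')) (≐-sym (↑↑ b'≐a))))
     (doubleton-inj₂ (weaken (∧E₂ h0)) h0 (↑↑ a≐a')))
  where
  b'≐a : Γ ⊩ b' ≐ a
  b'≐a = singleton-≐ sa (doubleton-∈₂ dab')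

ordPair-inj₂ : ∀ {n} {Γ : Ctx n} {v a b a' b' : Fin n} →
               Γ ⊩ IsOrdPair v a b → Γ ⊩ IsOrdPair v a' b' → Γ ⊩ b ≐ b'
ordPair-inj₂ {Γ = Γ} {a = a} {a' = a'} p p' = ∃E (∧E₁ (∧E₂ p')) (
  ∨E (ordPair-∈ (↑ p) (∧E₁ h0))
     (ordPair-inj₂-singleton (↑↑ p) (↑↑ p') (↑↑ a≐a') h0 (weaken (∧E₂ h0)))
     (doubleton-inj₂ h0 (weaken (∧E₂ h0)) (↑↑ a≐a')))
  where
  a≐a' : Γ ⊩ a ≐ a'
  a≐a' = ordPair-inj₁ p p'

Empty⇒rel : ∀ {n} {Γ : Ctx n} {t e : Fin n} → Γ ⊩ Empty e → Γ ⊩ rel t (Empty e)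
Empty⇒rel e = ∀I (⇒I (weaken (∀E zero (⊩-ren suc e))))

IsSingleton⇒rel : ∀ {n} {Γ : Ctx n} {t s a : Fin n} → Γ ⊩ IsSingleton s a → Γ ⊩ rel t (IsSingleton s a)
IsSingleton⇒rel sa = ∧I (∧E₁ sa) (∀I (⇒I (weaken (∀E zero (⊩-ren suc (∧E₂ sa))))))

rel⇒IsSingleton : ∀ {n} {Γ : Ctx n} {t s a : Fin n} → Γ ⊩ transitive t → Γ ⊩ s ∈ᶠ t →
                  Γ ⊩ rel t (IsSingleton s a) → Γ ⊩ IsSingleton s a
rel⇒IsSingleton tr s∈t sa =
  ∧I (∧E₁ sa) (∀I (⇒I (⇒E (⇒E (∀E zero (↑ (∧E₂ sa))) (transitive-∈ (↑ tr) (↑ s∈t) h0)) h0)))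

IsDoubleton⇒rel : ∀ {n} {Γ : Ctx n} {t s a b : Fin n} → Γ ⊩ IsDoubleton s a b → Γ ⊩ rel t (IsDoubleton s a b)
IsDoubleton⇒rel dab =
  ∧I (∧E₁ dab) (∧I (∧E₁ (∧E₂ dab)) (∀I (⇒I (weaken (∀E zero (⊩-ren suc (∧E₂ (∧E₂ dab))))))))

rel⇒IsDoubleton : ∀ {n} {Γ : Ctx n} {t s a b : Fin n} → Γ ⊩ transitive t → Γ ⊩ s ∈ᶠ t →
                  Γ ⊩ rel t (IsDoubleton s a b) → Γ ⊩ IsDoubleton s a b
rel⇒IsDoubleton tr s∈t dab = ∧I (∧E₁ dab) (∧I (∧E₁ (∧E₂ dab))
  (∀I (⇒I (⇒E (⇒E (∀E zero (↑ (∧E₂ (∧E₂ dab)))) (transitive-∈ (↑ tr) (↑ s∈t) h0)) h0))))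

IsOrdPair⇒rel : ∀ {n} {Γ : Ctx n} {t v a b : Fin n} → Γ ⊩ transitive t → Γ ⊩ v ∈ᶠ t →
                Γ ⊩ IsOrdPair v a b → Γ ⊩ rel t (IsOrdPair v a b)
IsOrdPair⇒rel {Γ = Γ} {t} {v} tr v∈t p =
  ∧I (∃E (∧E₁ p) (∃∈I zero (member∈t (∧E₁ h0)) (∧I (∧E₁ h0) (IsSingleton⇒rel (∧E₂ h0)))))
  (∧I (∃E (∧E₁ (∧E₂ p)) (∃∈I zero (member∈t (∧E₁ h0)) (∧I (∧E₁ h0) (IsDoubleton⇒rel (∧E₂ h0)))))
  (∀I (⇒I (⇒I (∨E (ordPair-∈ (↑↑ p) h0) (∨I₁ (IsSingleton⇒rel h0)) (∨I₂ (IsDoubleton⇒rel h0)))))))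
  where
  member∈t : ∀ {ψ} → renCtx suc Γ ▸ ψ ⊩ zero ∈ᶠ suc v → renCtx suc Γ ▸ ψ ⊩ zero ∈ᶠ suc t
  member∈t = transitive-∈ (↑ tr) (↑ v∈t)

rel⇒IsOrdPair : ∀ {n} {Γ : Ctx n} {t v a b : Fin n} → Γ ⊩ transitive t → Γ ⊩ v ∈ᶠ t →
                Γ ⊩ rel t (IsOrdPair v a b) → Γ ⊩ IsOrdPair v a b
rel⇒IsOrdPair {Γ = Γ} {t} {v} tr v∈t p =
  ∧I (∃∈E (∧E₁ p) (∃I zero (∧I (∧E₁ h0) (rel⇒IsSingleton (↑↑ tr) h1 (∧E₂ h0)))))
  (∧I (∃∈E (∧E₁ (∧E₂ p)) (∃I zero (∧I (∧E₁ h0) (rel⇒IsDoubleton (↑↑ tr) h1 (∧E₂ h0)))))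
  (∀I (⇒I (∨E (⇒E (⇒E (∀E zero (↑ (∧E₂ (∧E₂ p)))) s∈t) h0)
         (∨I₁ (rel⇒IsSingleton (↑↑ tr) (weaken s∈t) h0))
         (∨I₂ (rel⇒IsDoubleton (↑↑ tr) (weaken s∈t) h0))))))
  where
  s∈t : renCtx suc Γ ▸ zero ∈ᶠ suc v ⊩ zero ∈ᶠ suc t
  s∈t = transitive-∈ (↑ tr) (↑ v∈t) h0

ordPair-⟨⟩ : ∀ {n} {Γ : Ctx n} (φ : Fm 2) {v a b a' b' : Fin n} →
             Γ ⊩ IsOrdPair v a' b' → Γ ⊩ IsOrdPair v a b →
             Γ ⊩ φ ⟨ a' ∷ b' ∷ [] ⟩ → Γ ⊩ φ ⟨ a ∷ b ∷ [] ⟩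
ordPair-⟨⟩ φ {a = a} {b} {a'} {b'} p' p =
  ⟨⟩-cong φ {a' ∷ b' ∷ []} {a ∷ b ∷ []} λ { zero → ordPair-inj₁ p' p ; (suc zero) → ordPair-inj₂ p' p }

rel-ordPair-⟨⟩ : ∀ {n} {Γ : Ctx n} (φ : Fm 2) {t v a b a' b' : Fin n} →
                 Γ ⊩ IsOrdPair v a' b' → Γ ⊩ IsOrdPair v a b →
                 Γ ⊩ rel t (φ ⟨ a' ∷ b' ∷ [] ⟩) → Γ ⊩ rel t (φ ⟨ a ∷ b ∷ [] ⟩)
rel-ordPair-⟨⟩ φ {a = a} {b} {a'} {b'} p' p =
  rel-⟨⟩-cong φ {xs = a' ∷ b' ∷ []} {a ∷ b ∷ []} λ { zero → ordPair-inj₁ p' p ; (suc zero) → ordPair-inj₂ p' p }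

rel⇒Empty : ∀ {n} {Γ : Ctx n} {t v : Fin n} → Γ ⊩ transitive t → Γ ⊩ v ∈ᶠ t →
            Γ ⊩ rel t (Empty v) → Γ ⊩ Empty v
rel⇒Empty tr v∈t e = ∀I (⇒I (⇒E (⇒E (∀E zero (↑ e)) (transitive-∈ (↑ tr) (↑ v∈t) h0)) h0))

ordPair-¬Empty : ∀ {n} {Γ : Ctx n} {v a b : Fin n} → Γ ⊩ IsOrdPair v a b → Γ ⊩ ¬ᶠ (Empty v)
ordPair-¬Empty p = ⇒I (∃E (weaken (∧E₁ p)) (⇒E (∀E zero h1) (∧E₁ h0)))

closedUnderPairs : ∀ {n} {Γ : Ctx n} {t : Fin n} → Γ ⊩ transitive t → Γ ⊩ rel t PairsExist →
                   Γ ⊩ ClosedUnderPairs t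
closedUnderPairs tr pairsᵗ =
  ∀I (⇒I (∀I (⇒I (∃∈E (⇒E (∀E zero (⇒E (∀E v1 (↑ (↑ pairsᵗ))) h1)) h0)
    (∃I zero (∧I h1 (rel⇒IsOrdPair (↑↑ (↑ (↑ tr))) h1 h0)))))))

-- Reflecting a binary formula

rp-instance : ∀ {n} {Γ : Ctx n} (θ : Fm 1) (x : Fin n) →
              Γ ⊩ ∃ᶠ (suc x ⊆ᶠ zero ∧ᶠ isSet zero ∧ᶠ transitive zero ∧ᶠ
                      ∀ᶠ (zero ∈ᶠ suc zero ⇒ (θ ⟨ v0 ∷ [] ⟩ ⇔ᶠ rel v1 (θ ⟨ v0 ∷ [] ⟩))))
rp-instance {n} θ x =
  cast (cong (λ φ → ∃ᶠ (suc x ⊆ᶠ zero ∧ᶠ isSet zero ∧ᶠ transitive zero ∧ᶠ ∀ᶠ (zero ∈ᶠ suc zero ⇒ φ)))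
             (cong₂ _⇔ᶠ_ θ-instance
                    (trans (cong (ren σ) (ren-rel τ v1 (ren (λ _ → v0) θ)))
                           (trans (ren-rel σ v1 (ren τ (ren (λ _ → v0) θ))) (cong (rel v1) θ-instance)))))
       (∀E x (theorem (ax (rp θ))))
  where
  σ : Fin (3 + n) → Fin (2 + n)
  σ = lift (lift (sub0 x))
  τ : Fin 3 → Fin (3 + n)
  τ = lift (lift (lift (λ ())))
  θ-instance : ren σ (ren τ (ren (λ _ → v0) θ)) ≡ θ ⟨ v0 ∷ [] ⟩
  θ-instance = trans (ren-∘ σ τ _) (trans (ren-∘ (σ ∘ τ) _ θ) (ren-as-⟨⟩ (λ { zero → refl }) θ))

module Reflection (Φ : Fm 2) where

  Θ : ∀ {n} → Fin n → Fm n
  Θ v = PairsExist ∧ᶠ (Empty v ∨ᶠ ∃ᶠ (∃ᶠ (IsOrdPair (suc (suc v)) v1 v0 ∧ᶠ Φ ⟨ v1 ∷ v0 ∷ [] ⟩)))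

  ren-Θ : ∀ {n m} (σ : Fin n → Fin m) v → ren σ (Θ v) ≡ Θ (σ v)
  ren-Θ σ v = cong (λ φ → PairsExist ∧ᶠ (Empty (σ v) ∨ᶠ ∃ᶠ (∃ᶠ (IsOrdPair (suc (suc (σ v))) v1 v0 ∧ᶠ φ))))
                   (ren-⟨⟩ (lift (lift σ)) (v1 ∷ v0 ∷ []) Φ)

  ReflectsΘ : ∀ {n} → Fin n → Fm n
  ReflectsΘ t = ∀ᶠ (zero ∈ᶠ suc t ⇒ (Θ zero ⇔ᶠ rel (suc t) (Θ zero)))

  ren-ReflectsΘ : ∀ {n m} (σ : Fin n → Fin m) t → ren σ (ReflectsΘ t) ≡ ReflectsΘ (σ t)
  ren-ReflectsΘ σ t =
    cong₂ (λ φ ψ → ∀ᶠ (zero ∈ᶠ suc (σ t) ⇒ (φ ⇔ᶠ ψ)))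
          (ren-Θ (lift σ) zero)
          (trans (ren-rel (lift σ) (suc t) _) (cong (rel (suc (σ t))) (ren-Θ (lift σ) zero)))

  ↑ReflectsΘ : ∀ {n} {Γ : Ctx n} {t ψ} → Γ ⊩ ReflectsΘ t → renCtx suc Γ ▸ ψ ⊩ ReflectsΘ (suc t)
  ↑ReflectsΘ {t = t} r = cast (ren-ReflectsΘ suc t) (↑ r)

  Θ-reflect : ∀ {n} {Γ : Ctx n} {t v : Fin n} → Γ ⊩ ReflectsΘ t → Γ ⊩ v ∈ᶠ t → Γ ⊩ Θ v ⇔ᶠ rel t (Θ v)
  Θ-reflect {t = t} {v} r v∈t =
    cast (cong₂ _⇔ᶠ_ (ren-Θ (sub0 v) zero)
                     (trans (ren-rel (sub0 v) (suc t) (Θ zero)) (cong (rel t) (ren-Θ (sub0 v) zero))))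
         (⇒E (∀E v r) v∈t)

  rp-Θ : ∀ {n} {Γ : Ctx n} (x : Fin n) →
         Γ ⊩ ∃ᶠ (suc x ⊆ᶠ zero ∧ᶠ isSet zero ∧ᶠ transitive zero ∧ᶠ ReflectsΘ zero)
  rp-Θ x =
    cast (cong (λ φ → ∃ᶠ (suc x ⊆ᶠ zero ∧ᶠ isSet zero ∧ᶠ transitive zero ∧ᶠ ∀ᶠ (zero ∈ᶠ suc zero ⇒ φ)))
               (cong (λ φ → φ ⇔ᶠ rel v1 φ) (trans (⟨⟩-as-ren (Θ zero) (v0 ∷ [])) (ren-Θ (lookup (v0 ∷ [])) zero))))
         (rp-instance (Θ zero) x)

  Φ⇒rel : ∀ {n} {Γ : Ctx n} {t v a b : Fin n} → Γ ⊩ transitive t → Γ ⊩ ReflectsΘ t → Γ ⊩ v ∈ᶠ t →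
          Γ ⊩ IsOrdPair v a b → Γ ⊩ Φ ⟨ a ∷ b ∷ [] ⟩ → Γ ⊩ rel t (Φ ⟨ a ∷ b ∷ [] ⟩)
  Φ⇒rel {Γ = Γ} {t} {v} {a} {b} tr r v∈t p φab =
    ∨E (∧E₂ (⇔E₁ (Θ-reflect r v∈t) Θv))
       (contradiction (rel⇒Empty (weaken tr) (weaken v∈t) h0) (weaken (ordPair-¬Empty p)))
       (∃∈E h0 (∃∈E h0 (cast (sym (ren²-rel-⟨⟩ suc suc t (a ∷ b ∷ []) Φ))
         (rel-ordPair-⟨⟩ Φ (rel⇒IsOrdPair (↑↑ (↑↑ (weaken tr))) (↑↑ (↑↑ (weaken v∈t))) (∧E₁ h0))
                           (↑↑ (↑↑ (weaken p))) (∧E₂ h0)))))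
    where
    Θv : Γ ⊩ Θ v
    Θv = ∧I pairsExist (∨I₂ (∃I a (∃I b (∧I p
           (cast (sym (ren²-⟨⟩ (sub0 b) (lift (sub0 a)) (v1 ∷ v0 ∷ []) Φ)) φab)))))

  rel⇒Φ : ∀ {n} {Γ : Ctx n} {t v a b : Fin n} → Γ ⊩ transitive t → Γ ⊩ ReflectsΘ t → Γ ⊩ rel t PairsExist →
          Γ ⊩ a ∈ᶠ t → Γ ⊩ b ∈ᶠ t → Γ ⊩ v ∈ᶠ t → Γ ⊩ IsOrdPair v a b →
          Γ ⊩ rel t (Φ ⟨ a ∷ b ∷ [] ⟩) → Γ ⊩ Φ ⟨ a ∷ b ∷ [] ⟩
  rel⇒Φ {Γ = Γ} {t} {v} {a} {b} tr r pairsᵗ a∈t b∈t v∈t p φᵗab =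
    ∨E (∧E₂ (⇔E₂ (Θ-reflect r v∈t) Θᵗv))
       (contradiction h0 (weaken (ordPair-¬Empty p)))
       (∃E h0 (∃E h0 (cast (sym (ren²-⟨⟩ suc suc (a ∷ b ∷ []) Φ))
         (ordPair-⟨⟩ Φ (∧E₁ h0) (↑ (↑ (weaken p))) (∧E₂ h0)))))
    where
    Θᵗv : Γ ⊩ rel t (Θ v)
    Θᵗv = ∧I pairsᵗ (∨I₂ (∃∈I a a∈t (∃∈I b b∈t (∧I (IsOrdPair⇒rel tr v∈t p)
            (cast (sym (ren²-rel-⟨⟩ (sub0 b) (lift (sub0 a)) (suc (suc t)) (v1 ∷ v0 ∷ []) Φ)) φᵗab)))))

  Φ⇔rel : ∀ {n} {Γ : Ctx n} {t v a b : Fin n} → Γ ⊩ transitive t → Γ ⊩ ReflectsΘ t → Γ ⊩ rel t PairsExist →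
          Γ ⊩ a ∈ᶠ t → Γ ⊩ b ∈ᶠ t → Γ ⊩ v ∈ᶠ t → Γ ⊩ IsOrdPair v a b →
          Γ ⊩ Φ ⟨ a ∷ b ∷ [] ⟩ ⇔ᶠ rel t (Φ ⟨ a ∷ b ∷ [] ⟩)
  Φ⇔rel tr r pairsᵗ a∈t b∈t v∈t p =
    ⇔I (Φ⇒rel (weaken tr) (weaken r) (weaken v∈t) (weaken p) h0)
       (rel⇒Φ (weaken tr) (weaken r) (weaken pairsᵗ) (weaken a∈t) (weaken b∈t) (weaken v∈t) (weaken p) h0)

  Reflects : ∀ {n} → Fin n → Fm n
  Reflects t = ∀ᶠ (zero ∈ᶠ suc t ⇒ ∀ᶠ (zero ∈ᶠ suc (suc t) ⇒
                 (Φ ⟨ v1 ∷ v0 ∷ [] ⟩ ⇔ᶠ rel (suc (suc t)) (Φ ⟨ v1 ∷ v0 ∷ [] ⟩))))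

  ren-Reflects : ∀ {n m} (σ : Fin n → Fin m) t → ren σ (Reflects t) ≡ Reflects (σ t)
  ren-Reflects σ t = cong₂ (λ φ ψ → ∀ᶠ (zero ∈ᶠ suc (σ t) ⇒ ∀ᶠ (zero ∈ᶠ suc (suc (σ t)) ⇒ (φ ⇔ᶠ ψ))))
                           (ren-⟨⟩ (lift (lift σ)) (v1 ∷ v0 ∷ []) Φ)
                           (ren-rel-⟨⟩ (lift (lift σ)) (suc (suc t)) (v1 ∷ v0 ∷ []) Φ)

  ↑Reflects : ∀ {n} {Γ : Ctx n} {t ψ} → Γ ⊩ Reflects t → renCtx suc Γ ▸ ψ ⊩ Reflects (suc t)
  ↑Reflects {t = t} r = cast (ren-Reflects suc t) (↑ r)

  ↑↑Reflects : ∀ {n} {Γ : Ctx n} {t ψ χ} → Γ ⊩ Reflects t → renCtx suc Γ ▸ ψ ▸ χ ⊩ Reflects (suc t)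
  ↑↑Reflects r = weaken (↑Reflects r)

  reflect : ∀ {n} {Γ : Ctx n} {t a b : Fin n} → Γ ⊩ Reflects t → Γ ⊩ a ∈ᶠ t → Γ ⊩ b ∈ᶠ t →
            Γ ⊩ Φ ⟨ a ∷ b ∷ [] ⟩ ⇔ᶠ rel t (Φ ⟨ a ∷ b ∷ [] ⟩)
  reflect {t = t} {a} {b} r a∈t b∈t =
    cast (cong₂ _⇔ᶠ_ (ren²-⟨⟩ (sub0 b) (lift (sub0 a)) (v1 ∷ v0 ∷ []) Φ)
                     (ren²-rel-⟨⟩ (sub0 b) (lift (sub0 a)) (suc (suc t)) (v1 ∷ v0 ∷ []) Φ))
         (⇒E (∀E b (⇒E (∀E a r) a∈t)) b∈t)

  reflect-as : ∀ {n} {Γ : Ctx n} {t a b : Fin n} {ψ : Fm n} → Φ ⟨ a ∷ b ∷ [] ⟩ ≡ ψ →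
               Γ ⊩ Reflects t → Γ ⊩ a ∈ᶠ t → Γ ⊩ b ∈ᶠ t → Γ ⊩ ψ ⇔ᶠ rel t ψ
  reflect-as {t = t} eq r a∈t b∈t = cast (cong (λ ψ → ψ ⇔ᶠ rel t ψ) eq) (reflect r a∈t b∈t)

  ReflectsΘ⇒Reflects : ∀ {n} {Γ : Ctx n} {t : Fin n} → Γ ⊩ transitive t → Γ ⊩ ReflectsΘ t →
                       Γ ⊩ rel t PairsExist → Γ ⊩ ClosedUnderPairs t → Γ ⊩ Reflects t
  ReflectsΘ⇒Reflects {t = t} tr r pairsᵗ closed =
    ∀I (⇒I (∀I (⇒I (∃E (⇒E (∀E zero (⇒E (∀E v1 (↑ (↑ closed))) h1)) h0)
      (cast (sym (cong₂ _⇔ᶠ_ (ren-⟨⟩ suc (v1 ∷ v0 ∷ []) Φ) (ren-rel-⟨⟩ suc (suc (suc t)) (v1 ∷ v0 ∷ []) Φ)))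
        (Φ⇔rel (↑ (↑ (↑ tr))) (↑ReflectsΘ (↑ReflectsΘ (↑ReflectsΘ r))) (↑ (↑ (↑ pairsᵗ)))
               (↑ h1) (↑ h0) (∧E₁ h0) (∧E₂ h0)))))))

  IsReflecting : ∀ {n} → Fin n → Fm n
  IsReflecting t = isSet t ∧ᶠ transitive t ∧ᶠ ∃ᶠ (zero ∈ᶠ suc t ∧ᶠ isSet zero ∧ᶠ Empty zero) ∧ᶠ
                   ClosedUnderPairs t ∧ᶠ Reflects t

  ren-IsReflecting : ∀ {n m} (σ : Fin n → Fin m) t → ren σ (IsReflecting t) ≡ IsReflecting (σ t)
  ren-IsReflecting σ t =
    cong (λ φ → isSet (σ t) ∧ᶠ transitive (σ t) ∧ᶠ ∃ᶠ (zero ∈ᶠ suc (σ t) ∧ᶠ isSet zero ∧ᶠ Empty zero) ∧ᶠ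
                ClosedUnderPairs (σ t) ∧ᶠ φ)
         (ren-Reflects σ t)

  module _ {n} {Γ : Ctx n} {t : Fin n} (R : Γ ⊩ IsReflecting t) where
    reflecting-isSet : Γ ⊩ isSet t
    reflecting-isSet = ∧E₁ R

    reflecting-transitive : Γ ⊩ transitive t
    reflecting-transitive = ∧E₁ (∧E₂ R)

    reflecting-∃empty : Γ ⊩ ∃ᶠ (zero ∈ᶠ suc t ∧ᶠ isSet zero ∧ᶠ Empty zero)
    reflecting-∃empty = ∧E₁ (∧E₂ (∧E₂ R))

    reflecting-closed : Γ ⊩ ClosedUnderPairs t
    reflecting-closed = ∧E₁ (∧E₂ (∧E₂ (∧E₂ R)))

    reflecting-reflects : Γ ⊩ Reflects t
    reflecting-reflects = ∧E₂ (∧E₂ (∧E₂ (∧E₂ R)))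

  isReflecting : ∀ {n} {Γ : Ctx n} {t e : Fin n} → Γ ⊩ isSet t → Γ ⊩ transitive t → Γ ⊩ ReflectsΘ t →
                 Γ ⊩ e ∈ᶠ t → Γ ⊩ isSet e → Γ ⊩ Empty e → Γ ⊩ IsReflecting t
  isReflecting {Γ = Γ} {t} {e} set tr r e∈t e-set e-empty =
    ∧I set (∧I tr (∧I (∃I e (∧I e∈t (∧I e-set e-empty))) (∧I closed (ReflectsΘ⇒Reflects tr r pairsᵗ closed))))
    where
    pairsᵗ : Γ ⊩ rel t PairsExist
    pairsᵗ = ∧E₁ (⇔E₁ (Θ-reflect r e∈t) (∧I pairsExist (∨I₁ e-empty)))
    closed : Γ ⊩ ClosedUnderPairs t
    closed = closedUnderPairs tr pairsᵗ

  ∃Reflecting∋ : ∀ {n} → Fin n → Fm n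
  ∃Reflecting∋ x = ∃ᶠ (suc x ∈ᶠ zero ∧ᶠ IsReflecting zero)

  ren-∃Reflecting∋ : ∀ {n m} (σ : Fin n → Fin m) x → ren σ (∃Reflecting∋ x) ≡ ∃Reflecting∋ (σ x)
  ren-∃Reflecting∋ σ x = cong (λ φ → ∃ᶠ (suc (σ x) ∈ᶠ zero ∧ᶠ φ)) (ren-IsReflecting (lift σ) zero)

  reflecting-set-∋ : ∀ {n} {Γ : Ctx n} (x : Fin n) → Γ ⊩ ∃Reflecting∋ x
  reflecting-set-∋ x =
    ∃E empty-exists (cast (sym (ren-∃Reflecting∋ suc x))
    (∃E (upair-exists (suc x) zero) (cast (sym (ren-∃Reflecting∋ suc (suc x)))
    (∃E (rp-Θ zero) (cast (sym (ren-∃Reflecting∋ suc (suc (suc x))))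
    (∃I zero (cast (cong (suc (suc (suc x)) ∈ᶠ zero ∧ᶠ_) (sym (ren-IsReflecting (sub0 zero) zero)))
      (∧I (⊆-∈ (∧E₁ h0) (upair-∈₁ h1))
          (isReflecting (∧E₁ (∧E₂ h0)) (∧E₁ (∧E₂ (∧E₂ h0))) (∧E₂ (∧E₂ (∧E₂ h0)))
                        (⊆-∈ (∧E₁ h0) (upair-∈₂ h1)) (↑ (↑ (∧E₁ h0))) (↑ (↑ (∧E₂ h0))))))))))))

-- Collection

module CollectionFromRP (φ : Fm 3) where

  Code′ : ∀ {n} → Fin n → Fin n → Fm (3 + n) → Fm n
  Code′ a b F = ∃ᶠ (∃ᶠ (IsOrdPair (suc (suc a)) v1 v0 ∧ᶠ (Empty (suc (suc b)) ⇒ ∃ᶠ F) ∧ᶠ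
                         ∀ᶠ (IsOrdPair (suc (suc (suc b))) v0 v0 ⇒ F)))

  Code : ∀ {n} → Fin n → Fin n → Fm n
  Code a b = Code′ a b (φ ⟨ v2 ∷ v0 ∷ v1 ∷ [] ⟩)

  ren-Code : ∀ {n m} (σ : Fin n → Fin m) a b → ren σ (Code a b) ≡ Code (σ a) (σ b)
  ren-Code σ a b = cong (Code′ (σ a) (σ b)) (ren-⟨⟩ (lift (lift (lift σ))) (v2 ∷ v0 ∷ v1 ∷ []) φ)

  Code-⟨⟩ : ∀ {n} (a b : Fin n) → Code v0 v1 ⟨ a ∷ b ∷ [] ⟩ ≡ Code a b
  Code-⟨⟩ a b = trans (⟨⟩-as-ren (Code v0 v1) (a ∷ b ∷ [])) (ren-Code (lookup (a ∷ b ∷ [])) v0 v1)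

  open Reflection (Code v0 v1)

  ∃φ⇒Code-empty : ∀ {n} {Γ : Ctx n} {a e x p : Fin n} → Γ ⊩ IsOrdPair a x p → Γ ⊩ Empty e →
                  Γ ⊩ ∃ᶠ (φ ⟨ suc x ∷ zero ∷ suc p ∷ [] ⟩) → Γ ⊩ Code a e
  ∃φ⇒Code-empty {x = x} {p} pa e-empty ∃φ =
    ∃I x (∃I p (∧I pa (∧I
      (⇒I (weaken (cast (cong ∃ᶠ (sym (ren²-⟨⟩ (lift (sub0 p)) (lift (lift (sub0 x))) (v2 ∷ v0 ∷ v1 ∷ []) φ))) ∃φ)))
      (∀I (⇒I (⊥E (⇒E (ordPair-¬Empty h0) (↑ e-empty))))))))

  Code-pair⇒φ : ∀ {n} {Γ : Ctx n} {a b x y p : Fin n} → Γ ⊩ IsOrdPair a x p → Γ ⊩ IsOrdPair b y y →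
                Γ ⊩ Code a b → Γ ⊩ φ ⟨ x ∷ y ∷ p ∷ [] ⟩
  Code-pair⇒φ {x = x} {y} {p} pa pb code =
    ∃E code (∃E h0 (cast (sym (ren²-⟨⟩ suc suc (x ∷ y ∷ p ∷ []) φ))
      (⟨⟩-cong φ {v1 ∷ suc (suc y) ∷ v0 ∷ []} {suc (suc x) ∷ suc (suc y) ∷ suc (suc p) ∷ []}
        (λ { zero → ordPair-inj₁ (∧E₁ h0) (↑ (↑ pa)) ; (suc zero) → ≐-refl _
           ; (suc (suc zero)) → ordPair-inj₂ (∧E₁ h0) (↑ (↑ pa)) })
        (cast (ren-⟨⟩ (sub0 (suc (suc y))) (v2 ∷ v0 ∷ v1 ∷ []) φ)
          (⇒E (∀E (suc (suc y)) (∧E₂ (∧E₂ h0))) (↑ (↑ pb)))))))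

  relφ⇒relCode-pair : ∀ {n} {Γ : Ctx n} {t a b x y p : Fin n} → Γ ⊩ transitive t →
                      Γ ⊩ a ∈ᶠ t → Γ ⊩ b ∈ᶠ t → Γ ⊩ x ∈ᶠ t → Γ ⊩ p ∈ᶠ t →
                      Γ ⊩ IsOrdPair a x p → Γ ⊩ IsOrdPair b y y →
                      Γ ⊩ rel t (φ ⟨ x ∷ y ∷ p ∷ [] ⟩) → Γ ⊩ rel t (Code a b)
  relφ⇒relCode-pair {Γ = Γ} {t} {a} {b} {x} {y} {p} tr a∈t b∈t x∈t p∈t pa pb φᵗ =
    ∃∈I x x∈t (∃∈I p p∈t (∧I (IsOrdPair⇒rel tr a∈t pa) (∧I
      (⇒I (contradiction (rel⇒Empty (weaken tr) (weaken b∈t) h0) (weaken (ordPair-¬Empty pb))))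
      (∀I (⇒I (⇒I (cast (sym (ren²-rel-⟨⟩ (lift (sub0 p)) (lift (lift (sub0 x))) (suc (suc (suc t)))
                                          (v2 ∷ v0 ∷ v1 ∷ []) φ))
        (rel-⟨⟩-cong φ {xs = suc x ∷ suc y ∷ suc p ∷ []} {suc x ∷ zero ∷ suc p ∷ []}
          (λ { zero → ≐-refl _ ; (suc zero) → y≐y′ ; (suc (suc zero)) → ≐-refl _ })
          (cast (ren-rel-⟨⟩ suc t (x ∷ y ∷ p ∷ []) φ) (↑↑ φᵗ))))))))))
    where
    y≐y′ : renCtx suc Γ ▸ zero ∈ᶠ suc t ▸ rel (suc t) (IsOrdPair (suc b) zero zero) ⊩ suc y ≐ zero
    y≐y′ = ordPair-inj₁ (↑↑ pb) (rel⇒IsOrdPair (↑↑ tr) (↑↑ b∈t) h0)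

  rel⇒φ : ∀ {n} {Γ : Ctx n} {t a x y p : Fin n} → Γ ⊩ transitive t → Γ ⊩ ClosedUnderPairs t → Γ ⊩ Reflects t →
          Γ ⊩ a ∈ᶠ t → Γ ⊩ x ∈ᶠ t → Γ ⊩ y ∈ᶠ t → Γ ⊩ p ∈ᶠ t → Γ ⊩ IsOrdPair a x p →
          Γ ⊩ rel t (φ ⟨ x ∷ y ∷ p ∷ [] ⟩) → Γ ⊩ φ ⟨ x ∷ y ∷ p ∷ [] ⟩
  rel⇒φ {Γ = Γ} {t} {a} {x} {y} {p} tr closed r a∈t x∈t y∈t p∈t pa φᵗ =
    ∃E (⇒E (∀E y (⇒E (∀E y closed) y∈t)) y∈t) (cast (sym (ren-⟨⟩ suc (x ∷ y ∷ p ∷ []) φ))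
      (Code-pair⇒φ (↑ pa) pb
        (⇔E₂ (reflect-as (Code-⟨⟩ (suc a) zero) (↑Reflects r) (↑ a∈t) b∈t)
            (relφ⇒relCode-pair (↑ tr) (↑ a∈t) b∈t (↑ x∈t) (↑ p∈t) (↑ pa) pb
              (cast (ren-rel-⟨⟩ suc t (x ∷ y ∷ p ∷ []) φ) (↑ φᵗ))))))
    where
    b∈t : renCtx suc Γ ▸ zero ∈ᶠ suc t ∧ᶠ IsOrdPair zero (suc y) (suc y) ⊩ zero ∈ᶠ suc t
    b∈t = ∧E₁ h0
    pb : renCtx suc Γ ▸ zero ∈ᶠ suc t ∧ᶠ IsOrdPair zero (suc y) (suc y) ⊩ IsOrdPair zero (suc y) (suc y)
    pb = ∧E₂ h0

  WitnessIn : ∀ {n} → Fin n → Fin n → Fin n → Fm n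
  WitnessIn t x p = ∃ᶠ (zero ∈ᶠ suc t ∧ᶠ φ ⟨ suc x ∷ zero ∷ suc p ∷ [] ⟩)

  ren-WitnessIn : ∀ {n m} (σ : Fin n → Fin m) t x p → ren σ (WitnessIn t x p) ≡ WitnessIn (σ t) (σ x) (σ p)
  ren-WitnessIn σ t x p = cong (λ ψ → ∃ᶠ (zero ∈ᶠ suc (σ t) ∧ᶠ ψ)) (ren-⟨⟩ (lift σ) (suc x ∷ zero ∷ suc p ∷ []) φ)

  ∃∈relφ⇒WitnessIn : ∀ {n} {Γ : Ctx n} {t a x p x′ p′ : Fin n} →
                     Γ ⊩ transitive t → Γ ⊩ ClosedUnderPairs t → Γ ⊩ Reflects t →
                     Γ ⊩ a ∈ᶠ t → Γ ⊩ x ∈ᶠ t → Γ ⊩ p ∈ᶠ t → Γ ⊩ IsOrdPair a x p → Γ ⊩ IsOrdPair a x′ p′ →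
                     Γ ⊩ ∃∈ t (rel (suc t) (φ ⟨ suc x′ ∷ zero ∷ suc p′ ∷ [] ⟩)) → Γ ⊩ WitnessIn t x p
  ∃∈relφ⇒WitnessIn {t = t} {a} {x} {p} {x′} {p′} tr closed r a∈t x∈t p∈t pa pa′ ∃φᵗ =
    ∃∈E ∃φᵗ (cast (sym (ren-WitnessIn suc t x p))
      (∃I zero (∧I h1 (cast (sym (ren-⟨⟩ (sub0 zero) (suc (suc x) ∷ zero ∷ suc (suc p) ∷ []) φ))
        (rel⇒φ (↑↑ tr) (↑↑ closed) (↑↑Reflects r) (↑↑ a∈t) (↑↑ x∈t) h1 (↑↑ p∈t) (↑↑ pa)
          (rel-⟨⟩-cong φ {xs = suc x′ ∷ zero ∷ suc p′ ∷ []} {suc x ∷ zero ∷ suc p ∷ []}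
            (λ { zero → ↑↑ (ordPair-inj₁ pa′ pa) ; (suc zero) → ≐-refl zero
               ; (suc (suc zero)) → ↑↑ (ordPair-inj₂ pa′ pa) })
            h0))))))

  collect : ∀ {n} {Γ : Ctx n} {t e a x p : Fin n} → Γ ⊩ transitive t → Γ ⊩ ClosedUnderPairs t → Γ ⊩ Reflects t →
            Γ ⊩ e ∈ᶠ t → Γ ⊩ Empty e → Γ ⊩ a ∈ᶠ t → Γ ⊩ x ∈ᶠ t → Γ ⊩ p ∈ᶠ t → Γ ⊩ IsOrdPair a x p →
            Γ ⊩ ∃ᶠ (φ ⟨ suc x ∷ zero ∷ suc p ∷ [] ⟩) → Γ ⊩ WitnessIn t x p
  collect {Γ = Γ} {t} {e} {a} {x} {p} tr closed r e∈t e-empty a∈t x∈t p∈t pa ∃φ =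
    ∃∈E codeᵗ (∃∈E h0 (cast (sym (trans (cong (ren suc) (ren-WitnessIn suc t x p)) (ren-WitnessIn suc _ _ _)))
      (∃∈relφ⇒WitnessIn (↑↑ (↑↑ tr)) (↑↑ (↑↑ closed)) (↑↑Reflects (↑↑Reflects r)) (↑↑ (↑↑ a∈t)) (↑↑ (↑↑ x∈t))
                        (↑↑ (↑↑ p∈t)) (↑↑ (↑↑ pa)) (rel⇒IsOrdPair (↑↑ (↑↑ tr)) (↑↑ (↑↑ a∈t)) (∧E₁ h0))
                        (⇒E (∧E₁ (∧E₂ h0)) (Empty⇒rel (↑↑ (↑↑ e-empty)))))))
    where
    codeᵗ : Γ ⊩ rel t (Code a e)
    codeᵗ = ⇔E₁ (reflect-as (Code-⟨⟩ a e) r a∈t e∈t) (∃φ⇒Code-empty pa e-empty ∃φ)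

  Total : ∀ {n} → Fin n → Fin n → Fm n
  Total w p = ∀ᶠ (zero ∈ᶠ suc w ⇒ ∃ᶠ (φ ⟨ v1 ∷ v0 ∷ suc (suc p) ∷ [] ⟩))

  ren-Total : ∀ {n m} (σ : Fin n → Fin m) w p → ren σ (Total w p) ≡ Total (σ w) (σ p)
  ren-Total σ w p = cong (λ ψ → ∀ᶠ (zero ∈ᶠ suc (σ w) ⇒ ∃ᶠ ψ)) (ren-⟨⟩ (lift (lift σ)) (v1 ∷ v0 ∷ suc (suc p) ∷ []) φ)

  BoundedBy : ∀ {n} → Fin n → Fin n → Fin n → Fm n
  BoundedBy v w p = ∀ᶠ (zero ∈ᶠ suc w ⇒ WitnessIn (suc v) zero (suc p))

  ren-BoundedBy : ∀ {n m} (σ : Fin n → Fin m) v w p → ren σ (BoundedBy v w p) ≡ BoundedBy (σ v) (σ w) (σ p)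
  ren-BoundedBy σ v w p = cong (λ ψ → ∀ᶠ (zero ∈ᶠ suc (σ w) ⇒ ψ)) (ren-WitnessIn (lift σ) (suc v) zero (suc p))

  bounded : ∀ {n} {Γ : Ctx n} {t w p : Fin n} → Γ ⊩ IsReflecting t → Γ ⊩ w ∈ᶠ t → Γ ⊩ p ∈ᶠ t →
            Γ ⊩ Total w p → Γ ⊩ BoundedBy t w p
  bounded {Γ = Γ} {t} {w} {p} R w∈t p∈t total =
    ∀I (⇒I (∃E (↑ (reflecting-∃empty R)) (cast (sym (ren-WitnessIn suc (suc t) zero (suc p)))
           (∃E (⇒E (∀E (suc (suc p)) (⇒E (∀E v1 (↑ (↑ closed))) (↑ x∈t))) (↑ (↑ p∈t)))
             (cast (sym (ren-WitnessIn suc (suc (suc t)) v1 (suc (suc p))))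
             (collect (↑ (↑ (↑ tr))) (↑ (↑ (↑ closed))) (↑Reflects (↑Reflects (↑Reflects r)))
                      (↑ (∧E₁ h0)) (↑ (∧E₂ (∧E₂ h0))) (∧E₁ h0) (↑ (↑ x∈t)) (↑ (↑ (↑ p∈t))) (∧E₂ h0)
                      (cast (cong ∃ᶠ (ren²-⟨⟩ (lift suc) (lift suc) (v1 ∷ v0 ∷ suc (suc p) ∷ []) φ)) (↑ (↑ ∃φ)))))))))
    where
    tr : Γ ⊩ transitive t
    tr = reflecting-transitive R
    closed : Γ ⊩ ClosedUnderPairs t
    closed = reflecting-closed R
    r : Γ ⊩ Reflects t
    r = reflecting-reflects R
    x∈t : renCtx suc Γ ▸ zero ∈ᶠ suc w ⊩ zero ∈ᶠ suc t
    x∈t = transitive-∈ (↑ tr) (↑ w∈t) h0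
    ∃φ : renCtx suc Γ ▸ zero ∈ᶠ suc w ⊩ ∃ᶠ (φ ⟨ v1 ∷ v0 ∷ suc (suc p) ∷ [] ⟩)
    ∃φ = cast (cong ∃ᶠ (ren-⟨⟩ (lift (sub0 zero)) (v1 ∷ v0 ∷ suc (suc (suc p)) ∷ []) φ))
              (⇒E (∀E zero (cast (ren-Total suc w p) (↑ total))) h0)

  ∃BoundedBy : ∀ {n} → Fin n → Fin n → Fm n
  ∃BoundedBy w p = ∃ᶠ (BoundedBy zero (suc w) (suc p))

  ren-∃BoundedBy : ∀ {n m} (σ : Fin n → Fin m) w p → ren σ (∃BoundedBy w p) ≡ ∃BoundedBy (σ w) (σ p)
  ren-∃BoundedBy σ w p = cong ∃ᶠ (ren-BoundedBy (lift σ) zero (suc w) (suc p))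

  collection-bound : ∀ {n} {Γ : Ctx n} {w p : Fin n} → Γ ⊩ Total w p → Γ ⊩ ∃BoundedBy w p
  collection-bound {Γ = Γ} {w} {p} total =
    ∃E (upair-exists w p) (cast (sym (ren-∃BoundedBy suc w p))
    (∃E (reflecting-set-∋ zero) (cast (sym (ren-∃BoundedBy suc (suc w) (suc p)))
    (∃I zero (cast (sym (ren-BoundedBy (sub0 zero) zero (suc (suc (suc w))) (suc (suc (suc p)))))
      (bounded (∧E₂ h0) (transitive-∈ tr (∧E₁ h0) (upair-∈₁ h1)) (transitive-∈ tr (∧E₁ h0) (upair-∈₂ h1))
               (cast (trans (cong (ren suc) (ren-Total suc w p)) (ren-Total suc (suc w) (suc p))) (↑ (↑ total)))))))))
    where
    tr : renCtx suc (renCtx suc Γ ▸ IsUPair zero (suc w) (suc p)) ▸ v1 ∈ᶠ zero ∧ᶠ IsReflecting zero ⊩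
         transitive zero
    tr = reflecting-transitive (∧E₂ h0)

  collection : ZFU+RP ⊢ Collection φ
  collection = subst (ZFU+RP ⊢_) (sym Collection-as) (derivation {Γ = ε} (∀I (∀I (⇒I (collection-bound h0)))))
    where
    Collection-as : Collection φ ≡ ∀ᶠ (∀ᶠ (Total v1 v0 ⇒ ∃BoundedBy v1 v0))
    Collection-as =
      cong₂ (λ ψ χ → ∀ᶠ (∀ᶠ (∀ᶠ (v0 ∈ᶠ v2 ⇒ ∃ᶠ ψ) ⇒ ∃ᶠ (∀ᶠ (v0 ∈ᶠ v3 ⇒ ∃ᶠ (v0 ∈ᶠ v2 ∧ᶠ χ))))))
            (ren-as-⟨⟩ (λ { zero → refl ; (suc zero) → refl ; (suc (suc zero)) → refl }) φ)
            (ren-as-⟨⟩ (λ { zero → refl ; (suc zero) → refl ; (suc (suc zero)) → refl }) φ)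

-- RP∼

PowerCover : ∀ {n} → Fin n → Fin n → Fm n
PowerCover P c = ∀ᶠ ((isSet zero ∧ᶠ zero ⊆ᶠ suc c) ⇒ zero ∈ᶠ suc P)

PowerCovers : ∀ {n} → Fm n
PowerCovers = ∀ᶠ (∃ᶠ (PowerCover zero v1))

powerCovers : ∀ {n} {Γ : Ctx n} → Γ ⊩ PowerCovers
powerCovers = ∀I (∃E (∀E zero (theorem (ax (zfu powerset))))
                (∃I zero (∀I (⇒I (⇔E₂ (∀E zero (∧E₂ h1)) h0)))))

module RP∼FromRP (φ : Fm 1) where

  Code′ : ∀ {n} → Fin n → Fin n → Fm n → Fm n
  Code′ a b F = (Empty a ⇒ F ∧ᶠ PowerCovers) ∧ᶠ (¬ᶠ (Empty a) ⇒ PowerCover a b)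

  Code : ∀ {n} → Fin n → Fin n → Fm n
  Code a b = Code′ a b (φ ⟨ b ∷ [] ⟩)

  ren-Code : ∀ {n m} (σ : Fin n → Fin m) a b → ren σ (Code a b) ≡ Code (σ a) (σ b)
  ren-Code σ a b = cong (Code′ (σ a) (σ b)) (ren-⟨⟩ σ (b ∷ []) φ)

  Code-⟨⟩ : ∀ {n} (a b : Fin n) → Code v0 v1 ⟨ a ∷ b ∷ [] ⟩ ≡ Code a b
  Code-⟨⟩ a b = trans (⟨⟩-as-ren (Code v0 v1) (a ∷ b ∷ [])) (ren-Code (lookup (a ∷ b ∷ [])) v0 v1)

  open Reflection (Code v0 v1)

  φ⇒rel-φ∧PowerCovers : ∀ {n} {Γ : Ctx n} {t e x : Fin n} → Γ ⊩ Reflects t → Γ ⊩ e ∈ᶠ t → Γ ⊩ x ∈ᶠ t →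
                        Γ ⊩ Empty e → Γ ⊩ φ ⟨ x ∷ [] ⟩ → Γ ⊩ rel t (φ ⟨ x ∷ [] ⟩) ∧ᶠ rel t PowerCovers
  φ⇒rel-φ∧PowerCovers r e∈t x∈t e-empty φx =
    ⇒E (∧E₁ (⇔E₁ (reflect-as (Code-⟨⟩ _ _) r e∈t x∈t)
                 (∧I (⇒I (weaken (∧I φx powerCovers))) (⇒I (contradiction (weaken e-empty) h0)))))
       (Empty⇒rel e-empty)

  rel⇒PowerCover : ∀ {n} {Γ : Ctx n} {t e y P : Fin n} → Γ ⊩ Reflects t → Γ ⊩ e ∈ᶠ t → Γ ⊩ isSet e →
                   Γ ⊩ Empty e → Γ ⊩ y ∈ᶠ t → Γ ⊩ P ∈ᶠ t → Γ ⊩ rel t (PowerCover P y) → Γ ⊩ PowerCover P y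
  rel⇒PowerCover {Γ = Γ} {t} {e} {y} {P} r e∈t e-set e-empty y∈t P∈t coverᵗ =
    ⇒E (∧E₂ (⇔E₂ (reflect-as (Code-⟨⟩ P y) r P∈t y∈t) codeᵗ)) (⇒I (⇒E (∀E e h0) (weaken e∈P)))
    where
    e∈P : Γ ⊩ e ∈ᶠ P
    e∈P = ⇒E (⇒E (∀E e coverᵗ) e∈t)
             (∧I e-set (∀I (⇒I (⇒I (⊥E (⇒E (∀E zero (weaken (weaken (⊩-ren suc e-empty)))) h0))))))
    codeᵗ : Γ ⊩ rel t (Code P y)
    codeᵗ = ∧I (⇒I (⊥E (⇒E (⇒E (∀E e h0) (weaken e∈t)) (weaken e∈P)))) (⇒I (weaken coverᵗ))

  subsets-∈ : ∀ {n} {Γ : Ctx n} {t e y : Fin n} → Γ ⊩ Reflects t → Γ ⊩ transitive t →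
              Γ ⊩ e ∈ᶠ t → Γ ⊩ isSet e → Γ ⊩ Empty e → Γ ⊩ rel t PowerCovers → Γ ⊩ y ∈ᶠ t →
              Γ ⊩ ∀ᶠ ((isSet zero ∧ᶠ zero ⊆ᶠ suc y) ⇒ zero ∈ᶠ suc t)
  subsets-∈ {y = y} r tr e∈t e-set e-empty coversᵗ y∈t =
    ∃∈E (⇒E (∀E y coversᵗ) y∈t)
      (∀I (⇒I (transitive-∈ (↑ (↑↑ tr)) (↑ h1)
        (⇒E (∀E zero (↑ (rel⇒PowerCover (↑↑Reflects r) (↑↑ e∈t) (↑↑ e-set) (↑↑ e-empty) (↑↑ y∈t) h1 h0))) h0))))

  reflecting⇒supertransitive : ∀ {n} {Γ : Ctx n} {t : Fin n} → Γ ⊩ IsReflecting t → Γ ⊩ rel t PowerCovers →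
                               Γ ⊩ supertransitive t
  reflecting⇒supertransitive {Γ = Γ} {t} R coversᵗ =
    ∃E (reflecting-∃empty R)
       (∧I (↑ (reflecting-isSet R)) (∧I (↑ tr)
         (∀I (⇒I (subsets-∈ (↑Reflects (↑Reflects r)) (↑ (↑ tr)) (↑ (∧E₁ h0)) (↑ (∧E₁ (∧E₂ h0)))
                            (↑ (∧E₂ (∧E₂ h0))) (↑ (↑ coversᵗ)) h0)))))
    where
    tr : Γ ⊩ transitive t
    tr = reflecting-transitive R
    r : Γ ⊩ Reflects t
    r = reflecting-reflects R

  ∃Supertransitive∋ : ∀ {n} → Fin n → Fm n
  ∃Supertransitive∋ x = ∃ᶠ (suc x ∈ᶠ zero ∧ᶠ supertransitive zero ∧ᶠ rel zero (φ ⟨ suc x ∷ [] ⟩))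

  ren-∃Supertransitive∋ : ∀ {n m} (σ : Fin n → Fin m) x → ren σ (∃Supertransitive∋ x) ≡ ∃Supertransitive∋ (σ x)
  ren-∃Supertransitive∋ σ x = cong (λ ψ → ∃ᶠ (suc (σ x) ∈ᶠ zero ∧ᶠ supertransitive zero ∧ᶠ ψ))
                                   (ren-rel-⟨⟩ (lift σ) zero (suc x ∷ []) φ)

  supertransitive-∋ : ∀ {n} {Γ : Ctx n} {x : Fin n} → Γ ⊩ φ ⟨ x ∷ [] ⟩ → Γ ⊩ ∃Supertransitive∋ x
  supertransitive-∋ {n} {Γ} {x} φx =
    ∃E (reflecting-set-∋ x) (cast (sym (ren-∃Supertransitive∋ suc x))
      (∃I zero (cast (cong (λ ψ → suc x ∈ᶠ zero ∧ᶠ supertransitive zero ∧ᶠ ψ)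
                           (sym (ren-rel-⟨⟩ (sub0 zero) zero (suc (suc x) ∷ []) φ)))
        (∧I x∈t (∧I (reflecting⇒supertransitive R (∧E₂ φᵗ∧coversᵗ)) (∧E₁ φᵗ∧coversᵗ))))))
    where
    Δ : Ctx (suc n)
    Δ = renCtx suc Γ ▸ suc x ∈ᶠ zero ∧ᶠ IsReflecting zero
    R : Δ ⊩ IsReflecting zero
    R = ∧E₂ h0
    x∈t : Δ ⊩ suc x ∈ᶠ zero
    x∈t = ∧E₁ h0
    φx′ : Δ ⊩ φ ⟨ suc x ∷ [] ⟩
    φx′ = cast (ren-⟨⟩ suc (x ∷ []) φ) (↑ φx)
    φᵗ∧coversᵗ : Δ ⊩ rel zero (φ ⟨ suc x ∷ [] ⟩) ∧ᶠ rel zero PowerCovers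
    φᵗ∧coversᵗ =
      ∃E (reflecting-∃empty R) (cast (sym (cong (_∧ᶠ rel v1 PowerCovers) (ren-rel-⟨⟩ suc zero (suc x ∷ []) φ)))
        (φ⇒rel-φ∧PowerCovers (↑Reflects (reflecting-reflects R)) (∧E₁ h0) (↑ x∈t) (∧E₂ (∧E₂ h0))
               (cast (ren-⟨⟩ suc (suc x ∷ []) φ) (↑ φx′))))

  rp∼ : ZFU+RP ⊢ RP∼ φ
  rp∼ = subst (ZFU+RP ⊢_) (sym RP∼-as) (derivation {Γ = ε} (∀I (⇒I (supertransitive-∋ h0))))
    where
    RP∼-as : RP∼ φ ≡ ∀ᶠ (φ ⟨ v0 ∷ [] ⟩ ⇒ ∃Supertransitive∋ v0)
    RP∼-as = cong₂ (λ ψ χ → ∀ᶠ (ψ ⇒ ∃ᶠ (v1 ∈ᶠ v0 ∧ᶠ supertransitive v0 ∧ᶠ rel v0 χ)))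
                   (sym (trans (⟨⟩-as-ren φ (v0 ∷ [])) (ren-id (λ { zero → refl }) φ)))
                   (ren-as-⟨⟩ (λ { zero → refl }) φ)

proposition3p1 : ((φ : Fm 3) → ZFU+RP ⊢ Collection φ) × ((φ : Fm 1) → ZFU+RP ⊢ RP∼ φ)
proposition3p1 = CollectionFromRP.collection , RP∼FromRP.rp∼
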